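{- Let $p$ be a prime and let $\theta\in\mathbb{F}_p((X^{ -1}))$ be a counterexample to the $X$-adic Littlewood conjecture over $\mathbb{F}_p$, and let $D(\theta)\in\mathbb{N}_0$ be such that for every $r\geq0$ all partial quotients $A^{(r)}_j$, $j\geq1$, of the continued fraction expansion of $\langle X^r\theta\rangle$ satisfy $\deg(A^{(r)}_j)\leq D(\theta)+1$. Then for every $m>D(\theta)$ the three $\mathbb{N}\times m$ matrices $I^{(m)}$, $H^{(m)}(\theta)$ and $J^{(m)}$ generate a digital $(D(\theta),m,3)$-net over $\mathbb{F}_p$.
   Context: For $\theta=\sum_{i=j}^\infty a_iX^{ -i}$ with $a_j\neq0$: $|\theta|=2^{ -j}$, $\langle\theta\rangle=\sum_{i\geq\max\{1,j\}}a_iX^{ -i}$, $\|\theta\|=|\langle\theta\rangle|$; counterexample means $\inf_{r\geq0,\ Q\in\mathbb{F}_p[X]\setminus\{0\}}|Q|\cdot\|X^rQ\theta\|>0$. $I^{(m)}$ consists of the first $m$ columns of the $\mathbb{N}\times\mathbb{N}_0$ unit matrix; $H^{(m)}(\theta)$ consists of the first $m$ columns of the Hankel matrix $H(\theta)$ whose row $k\geq1$ is $(a_k,a_{k+1},a_{k+2},\dots)$ (with $a_1=\cdots=a_{j-1}=0$ if $j>1$); $J^{(m)}$ is the $\mathbb{N}\times m$ upper antidiagonal matrix, whose $k$-th row for $1\leq k\leq m$ is the unit vector with $1$ in column $m-k+1$ (columns indexed $1,\dots,m$) and whose rows $k>m$ are zero. Digital $(t,m,3)$-net over $\mathbb{F}_p$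 ($t\in\mathbb{N}_0$, $t<m$): $\mathbb{N}\times m$ matrices $C_1,C_2,C_3$ over $\mathbb{F}_p$ generate a digital $(t,m,3)$-net if for all $d_1,d_2,d_3\in\mathbb{N}_0$ with $d_1+d_2+d_3\leq m-t$, the matrix consisting of the upper $d_1$ rows of $C_1$, the upper $d_2$ rows of $C_2$ and the upper $d_3$ rows of $C_3$ has full row rank $d_1+d_2+d_3$. -}

module Defs where

open import Data.Nat as ℕ using (ℕ; zero; suc; _≤_; _<_; _∸_; _⊔_; _≟_)
open import Data.Nat.Divisibility using (_∣_)
open import Data.Integer as ℤ using (ℤ; +_; -[1+_]; 0ℤ; 1ℤ; ∣_∣; _-_)
open import Data.Fin using (Fin; toℕ)
open import Data.Bool using (if_then_else_)
open import Data.Product using (_×_; ∃-syntax)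
open import Relation.Nullary using (¬_)
open import Relation.Nullary.Decidable using (⌊_⌋)
open import Relation.Binary.PropositionalEquality using (_≡_; _≢_)

-- Elements of F_p are represented by integers; an integer x is zero in
-- F_p iff p divides x.

IsZeroₚ : ℕ → ℤ → Set
IsZeroₚ p x = p ∣ ∣ x ∣

_≡[_]_ : ℤ → ℕ → ℤ → Set
x ≡[ p ] y = IsZeroₚ p (x - y)

sumℕ : ℕ → (ℕ → ℤ) → ℤ
sumℕ zero    f = 0ℤ
sumℕ (suc n) f = sumℕ n f ℤ.+ f n

sumFin : (n : ℕ) → (Fin n → ℤ) → ℤ
sumFin zero    f = 0ℤ
sumFin (suc n) f = f Fin.zero ℤ.+ sumFin n (λ i → f (Fin.suc i))

-- Laurent series in X^{-1} (coefficients: integer representatives of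
-- elements of F_p).  The record  mk s c  stands for  Σ_{k≥0} c k · X^(s-k).

record LSeries : Set where
  constructor mk
  field
    shift : ℕ
    coef  : ℕ → ℤ
open LSeries public

-- coefficient of X^{-i} (i ∈ ℤ), i.e. index k = i + shift
atℤ : (ℕ → ℤ) → ℤ → ℤ
atℤ c (+ n)      = c n
atℤ c -[1+ _ ]   = 0ℤ

coeffAt : LSeries → ℤ → ℤ
coeffAt f i = atℤ (coef f) (i ℤ.+ + shift f)

_≈[_]_ : LSeries → ℕ → LSeries → Set
f ≈[ p ] g = ∀ (i : ℤ) → coeffAt f i ≡[ p ] coeffAt g i

_*L_ : LSeries → LSeries → LSeries
f *L g = mk (shift f ℕ.+ shift g)
            (λ n → sumℕ (suc n) (λ k → coef f k ℤ.* coef g (n ∸ k)))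

_+L_ : LSeries → LSeries → LSeries
f +L g = mk S (λ n → coeffAt f (+ n - + S) ℤ.+ coeffAt g (+ n - + S))
  where S = shift f ⊔ shift g

oneL : LSeries
oneL = mk 0 (λ { zero → 1ℤ ; (suc _) → 0ℤ })

Xpow : ℕ → LSeries
Xpow r = mk r (λ { zero → 1ℤ ; (suc _) → 0ℤ })

frac : LSeries → LSeries
frac f = mk 0 (λ { zero → 0ℤ ; (suc i) → coeffAt f (+ suc i) })

-- the polynomial Σ_{l=0}^{d} q l · X^l  (coefficients with index > d ignored)
poly : (p d : ℕ) → (ℕ → Fin p) → LSeries
poly p d q = mk d (λ k → if ⌊ k ℕ.≤? d ⌋ then + toℕ (q (d ∸ k)) else 0ℤ)

-- An element of F_p((X^{-1})):  Σ_{k≥0} digit k · X^(shift-k)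

record FpLaurent (p : ℕ) : Set where
  constructor fpl
  field
    lshift : ℕ
    digit  : ℕ → Fin p
open FpLaurent public

toL : ∀ {p} → FpLaurent p → LSeries
toL θ = mk (lshift θ) (λ k → + toℕ (digit θ k))

-- Counterexample to the X-adic Littlewood conjecture:
--   inf_{r ≥ 0, Q ≠ 0} |Q| · ‖X^r Q θ‖ > 0.
-- With |Q| = 2^{deg Q} and ‖φ‖ = 2^{-v}, v the least i ≥ 1 with nonzero
-- coefficient of X^{-i} in ⟨φ⟩ (‖φ‖ = 0 if ⟨φ⟩ = 0), this says: there is
-- k ∈ ℕ with |Q|·‖X^r Q θ‖ ≥ 2^{-k} for all r and all nonzero Q, i.e.
-- ⟨X^r Q θ⟩ has a nonzero coefficient at some X^{-i}, 1 ≤ i ≤ deg Q + k.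
-- A nonzero Q of degree d is given by q with q d ≠ 0.

Counterexample : (p : ℕ) → FpLaurent p → Set
Counterexample p θ =
  ∃[ k ] ∀ (r d : ℕ) (q : ℕ → Fin p) → toℕ (q d) ≢ 0 →
    ∃[ i ] (1 ≤ i × i ≤ d ℕ.+ k ×
      ¬ IsZeroₚ p (coeffAt (frac (Xpow r *L (poly p d q *L toL θ))) (+ i)))

-- Continued fraction expansion of φ (|φ| < 1), infinite:
--   φ₀ = φ,   1/φ_{j-1} = A_j + φ_j,  A_j ∈ F_p[X],  |φ_j| < 1   (j ≥ 1).
-- Field indexing: pqDeg j, pqCoef j describe A_{j+1} (deg and
-- coefficients, leading coefficient nonzero), rem j is φ_j.

record CFExpansion (p : ℕ) (φ : LSeries) : Set where
  field
    pqDeg  : ℕ → ℕ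
    pqCoef : ℕ → ℕ → Fin p
    pqLead : ∀ j → toℕ (pqCoef j (pqDeg j)) ≢ 0
    rem    : ℕ → LSeries
    rem₀   : rem 0 ≈[ p ] φ
    remFrac : ∀ j → rem j ≈[ p ] frac (rem j)          -- |φ_j| < 1
    step   : ∀ j → (rem j *L (poly p (pqDeg j) (pqCoef j) +L rem (suc j))) ≈[ p ] oneL
open CFExpansion public

PQBound : (p : ℕ) → FpLaurent p → ℕ → Set
PQBound p θ D = ∀ (r : ℕ) (E : CFExpansion p (frac (Xpow r *L toL θ))) →
  ∀ j → pqDeg E j ≤ suc D

-- N × m matrices: row index k : ℕ stands for row k+1, column c : Fin m
-- stands for column (toℕ c)+1.

Mat : ℕ → Set
Mat m = ℕ → Fin m → ℤ

δ : ℕ → ℕ → ℤ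
δ a b = if ⌊ a ≟ b ⌋ then 1ℤ else 0ℤ

Imat : (m : ℕ) → Mat m
Imat m k c = δ k (toℕ c)

-- H^{(m)}(θ): entry (row k, column c) (1-based) is a_{k+c-1}, where a_i is
-- the coefficient of X^{-i} in θ (i ≥ 1)
Hmat : LSeries → (m : ℕ) → Mat m
Hmat θ m k c = coeffAt θ (+ (suc k ℕ.+ toℕ c))

-- J^{(m)}: row k (1-based, k ≤ m) has 1 in column m-k+1; rows k > m zero.
-- 0-based: 1 iff k + c + 1 = m.
Jmat : (m : ℕ) → Mat m
Jmat m k c = δ (suc (k ℕ.+ toℕ c)) m

stackRow : ∀ {m} → Mat m → Mat m → Mat m → ℕ → ℕ → ℕ → Fin m → ℤ
stackRow C₁ C₂ C₃ d₁ d₂ i c =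
  if ⌊ i ℕ.<? d₁ ⌋ then C₁ i c
  else if ⌊ i ℕ.<? d₁ ℕ.+ d₂ ⌋ then C₂ (i ∸ d₁) c
  else C₃ (i ∸ (d₁ ℕ.+ d₂)) c

FullRowRank : (p n m : ℕ) → (Fin n → Fin m → ℤ) → Set
FullRowRank p n m M =
  ∀ (a : Fin n → ℤ) → (∀ c → IsZeroₚ p (sumFin n (λ i → a i ℤ.* M i c))) →
  ∀ i → IsZeroₚ p (a i)

DigitalNet3 : (p t m : ℕ) → Mat m → Mat m → Mat m → Set
DigitalNet3 p t m C₁ C₂ C₃ =
  t < m × (∀ d₁ d₂ d₃ → d₁ ℕ.+ d₂ ℕ.+ d₃ ≤ m ∸ t →
    FullRowRank p (d₁ ℕ.+ d₂ ℕ.+ d₃) m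
      (λ i c → stackRow C₁ C₂ C₃ d₁ d₂ (toℕ i) c))

-- A counterexample θ makes every ⟨X^r θ⟩ badly approximable, so its continued fraction never
-- terminates and, by hypothesis, all its partial quotients have degree at most D + 1.  Running the
-- Euclidean algorithm backwards then gives |Q|·‖Q ⟨X^r θ⟩‖ ≥ 2^(-(D+1)) for every nonzero Q: a Q of
-- degree below the degree a of the first partial quotient cannot cancel the leading term X^(-a) of
-- the series, and a Q of degree a + e approximating it too well yields a polynomial of degree e
-- approximating the next remainder too well.  Now take a vanishing combination of the first d₁
-- rows of I, d₂ rows of H(θ) and d₃ rows of J.  If its H-part b_0, …, b_d ends in b_d ≠ 0, then
-- the columns d₁ + 1, …, d₁ + d + D + 1 meet neither the I- nor the J-part, and they say that
-- ‖Q ⟨X^(d₁) θ⟩‖ < 2^(-(d+D+1)) for Q = Σ b_j X^j, which is impossible.  So the H-part vanishes,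
-- and then the I- and J-parts vanish column by column.

{-# OPTIONS --safe #-}
module Submission where

open import Defs
open import Function using (_∘_)
open import Data.Empty using (⊥; ⊥-elim)
open import Data.Fin as Fin using (Fin; toℕ; fromℕ<)
import Data.Fin.Properties as FinP
open import Data.Integer as ℤ using (ℤ; +_; -[1+_]; 0ℤ; 1ℤ)
import Data.Integer.DivMod as ℤDM
import Data.Integer.Divisibility.Signed as ℤD
import Data.Integer.Properties as ℤP
open import Data.Integer.Tactic.RingSolver using (solve-∀)
open import Data.Nat as ℕ using (ℕ; zero; suc; _+_; _∸_; _≤_; _<_; z≤n; s≤s)
open import Data.Nat.Coprimality using (Coprime; coprime-Bézout)
import Data.Nat.Divisibility as ℕD
open import Data.Nat.GCD using (module Bézout)
open import Data.Nat.Induction using (<-rec)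
open import Data.Nat.Primality using (Prime; euclidsLemma; prime⇒irreducible; prime⇒nonTrivial; prime⇒nonZero)
import Data.Nat.Properties as ℕP
import Data.Nat.Tactic.RingSolver as ℕSolver
open import Data.Product using (_×_; _,_; proj₁; proj₂; Σ; ∃-syntax)
open import Data.Sum as Sum using (_⊎_; inj₁; inj₂)
open import Relation.Binary.Bundles using (Setoid)
open import Relation.Binary.PropositionalEquality
import Relation.Binary.Reasoning.Setoid as SetoidReasoning
open import Relation.Nullary using (¬_; Dec; yes; no; contradiction)

suc[d+i]∸j : ∀ d i {j} → j ≤ d → suc (d + i) ∸ j ≡ suc (d ∸ j + i)
suc[d+i]∸j d i j≤d = trans (ℕP.+-∸-assoc 1 (ℕP.≤-trans j≤d (ℕP.m≤m+n d i))) (cong suc (ℕP.+-∸-comm i j≤d))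

<1+n-cases : ∀ {n j} {P : ℕ → Set} → j < suc n → P n → (j < n → P j) → P j
<1+n-cases j<1+n Pn below with ℕP.m<1+n⇒m<n∨m≡n j<1+n
... | inj₁ j<n  = below j<n
... | inj₂ refl = Pn

sumℕ-cong : ∀ n {f g : ℕ → ℤ} → (∀ k → k < n → f k ≡ g k) → sumℕ n f ≡ sumℕ n g
sumℕ-cong zero    f≡g = refl
sumℕ-cong (suc n) f≡g =
  cong₂ ℤ._+_ (sumℕ-cong n (λ k k<n → f≡g k (ℕP.m<n⇒m<1+n k<n))) (f≡g n ℕP.≤-refl)

sumℕ-head : ∀ n (f : ℕ → ℤ) → sumℕ (suc n) f ≡ f 0 ℤ.+ sumℕ n (f ∘ suc)
sumℕ-head zero    f = ℤP.+-comm 0ℤ (f 0)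
sumℕ-head (suc n) f = begin
  sumℕ (suc n) f ℤ.+ f (suc n)                ≡⟨ cong (ℤ._+ f (suc n)) (sumℕ-head n f) ⟩
  (f 0 ℤ.+ sumℕ n (f ∘ suc)) ℤ.+ f (suc n)    ≡⟨ ℤP.+-assoc (f 0) _ _ ⟩
  f 0 ℤ.+ sumℕ (suc n) (f ∘ suc)              ∎
  where open ≡-Reasoning

sumℕ-0 : ∀ n → sumℕ n (λ _ → 0ℤ) ≡ 0ℤ
sumℕ-0 zero    = refl
sumℕ-0 (suc n) = cong (ℤ._+ 0ℤ) (sumℕ-0 n)

sumℕ-+ : ∀ n (f g : ℕ → ℤ) → sumℕ n (λ k → f k ℤ.+ g k) ≡ sumℕ n f ℤ.+ sumℕ n g
sumℕ-+ zero    f g = refl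
sumℕ-+ (suc n) f g = begin
  sumℕ n (λ k → f k ℤ.+ g k) ℤ.+ (f n ℤ.+ g n)   ≡⟨ cong (ℤ._+ (f n ℤ.+ g n)) (sumℕ-+ n f g) ⟩
  (sumℕ n f ℤ.+ sumℕ n g) ℤ.+ (f n ℤ.+ g n)      ≡⟨ swap (sumℕ n f) (sumℕ n g) (f n) (g n) ⟩
  (sumℕ n f ℤ.+ f n) ℤ.+ (sumℕ n g ℤ.+ g n)      ∎
  where
  open ≡-Reasoning
  swap : ∀ a b c d → (a ℤ.+ b) ℤ.+ (c ℤ.+ d) ≡ (a ℤ.+ c) ℤ.+ (b ℤ.+ d)
  swap = solve-∀

sumℕ-neg : ∀ n (f : ℕ → ℤ) → sumℕ n (λ k → ℤ.- f k) ≡ ℤ.- sumℕ n f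
sumℕ-neg zero    f = refl
sumℕ-neg (suc n) f =
  trans (cong (ℤ._+ ℤ.- f n) (sumℕ-neg n f)) (sym (ℤP.neg-distrib-+ (sumℕ n f) (f n)))

sumℕ-*ˡ : ∀ n c (f : ℕ → ℤ) → sumℕ n (λ k → c ℤ.* f k) ≡ c ℤ.* sumℕ n f
sumℕ-*ˡ zero    c f = sym (ℤP.*-zeroʳ c)
sumℕ-*ˡ (suc n) c f =
  trans (cong (ℤ._+ c ℤ.* f n) (sumℕ-*ˡ n c f)) (sym (ℤP.*-distribˡ-+ c (sumℕ n f) (f n)))

sumℕ-*ʳ : ∀ n c (f : ℕ → ℤ) → sumℕ n (λ k → f k ℤ.* c) ≡ sumℕ n f ℤ.* c
sumℕ-*ʳ n c f = begin
  sumℕ n (λ k → f k ℤ.* c)  ≡⟨ sumℕ-cong n (λ k _ → ℤP.*-comm (f k) c) ⟩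
  sumℕ n (λ k → c ℤ.* f k)  ≡⟨ sumℕ-*ˡ n c f ⟩
  c ℤ.* sumℕ n f            ≡⟨ ℤP.*-comm c _ ⟩
  sumℕ n f ℤ.* c            ∎
  where open ≡-Reasoning

sumℕ-split : ∀ m n (f : ℕ → ℤ) → sumℕ (m + n) f ≡ sumℕ m f ℤ.+ sumℕ n (λ k → f (m + k))
sumℕ-split m zero    f = trans (cong (λ x → sumℕ x f) (ℕP.+-identityʳ m)) (sym (ℤP.+-identityʳ _))
sumℕ-split m (suc n) f = begin
  sumℕ (m + suc n) f                                         ≡⟨ cong (λ x → sumℕ x f) (ℕP.+-suc m n) ⟩
  sumℕ (m + n) f ℤ.+ f (m + n)                               ≡⟨ cong (ℤ._+ f (m + n)) (sumℕ-split m n f) ⟩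
  (sumℕ m f ℤ.+ sumℕ n (λ k → f (m + k))) ℤ.+ f (m + n)      ≡⟨ ℤP.+-assoc (sumℕ m f) _ _ ⟩
  sumℕ m f ℤ.+ sumℕ (suc n) (λ k → f (m + k))                ∎
  where open ≡-Reasoning

sumℕ-reverse : ∀ n (f : ℕ → ℤ) → sumℕ n f ≡ sumℕ n (λ k → f (n ∸ suc k))
sumℕ-reverse zero    f = refl
sumℕ-reverse (suc n) f = begin
  sumℕ n f ℤ.+ f n                             ≡⟨ cong (ℤ._+ f n) (sumℕ-reverse n f) ⟩
  sumℕ n (λ k → f (n ∸ suc k)) ℤ.+ f n         ≡⟨ ℤP.+-comm _ (f n) ⟩
  f n ℤ.+ sumℕ n (λ k → f (n ∸ suc k))         ≡⟨ sym (sumℕ-head n (λ k → f (suc n ∸ suc k))) ⟩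
  sumℕ (suc n) (λ k → f (suc n ∸ suc k))       ∎
  where open ≡-Reasoning

sumℕ-triangle : ∀ n (F : ℕ → ℕ → ℤ) →
  sumℕ n (λ k → sumℕ (suc k) (λ j → F j k)) ≡ sumℕ n (λ j → sumℕ (n ∸ j) (λ l → F j (j + l)))
sumℕ-triangle zero    F = refl
sumℕ-triangle (suc n) F = begin
  sumℕ n (λ k → sumℕ (suc k) (λ j → F j k)) ℤ.+ sumℕ (suc n) (λ j → F j n)
    ≡⟨ cong (ℤ._+ sumℕ (suc n) (λ j → F j n)) (sumℕ-triangle n F) ⟩
  sumℕ n row ℤ.+ sumℕ (suc n) (λ j → F j n)
    ≡⟨ cong (ℤ._+ sumℕ (suc n) (λ j → F j n)) (sym (trans (cong (λ x → sumℕ n row ℤ.+ x) last-row) (ℤP.+-identityʳ (sumℕ n row)))) ⟩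
  sumℕ (suc n) row ℤ.+ sumℕ (suc n) (λ j → F j n)
    ≡⟨ sym (sumℕ-+ (suc n) row (λ j → F j n)) ⟩
  sumℕ (suc n) (λ j → row j ℤ.+ F j n)
    ≡⟨ sumℕ-cong (suc n) extend-row ⟩
  sumℕ (suc n) (λ j → sumℕ (suc n ∸ j) (λ l → F j (j + l)))   ∎
  where
  open ≡-Reasoning
  row : ℕ → ℤ
  row j = sumℕ (n ∸ j) (λ l → F j (j + l))
  last-row : row n ≡ 0ℤ
  last-row = cong (λ x → sumℕ x (λ l → F n (n + l))) (ℕP.n∸n≡0 n)
  extend-row : ∀ j → j < suc n → row j ℤ.+ F j n ≡ sumℕ (suc n ∸ j) (λ l → F j (j + l))
  extend-row j (s≤s j≤n) = begin
    row j ℤ.+ F j n                             ≡⟨ cong (λ x → row j ℤ.+ F j x) (sym (ℕP.m+[n∸m]≡n j≤n)) ⟩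
    sumℕ (suc (n ∸ j)) (λ l → F j (j + l))      ≡⟨ cong (λ x → sumℕ x (λ l → F j (j + l))) (sym (ℕP.+-∸-assoc 1 j≤n)) ⟩
    sumℕ (suc n ∸ j) (λ l → F j (j + l))        ∎

-- Power series

-- A series s stands for Σ s n X^(-n).  A polynomial Q of degree d is stored from the top, Q n being
-- the coefficient of X^(d-n) (so Q 0 is the leading one); then (Q ⊛ s) (d + i) is the coefficient
-- of X^(-i) in Q s.
Series : Set
Series = ℕ → ℤ

infixl 7 _⊛_
infixl 6 _⊕_ _⊖_

_⊛_ : Series → Series → Series
(f ⊛ g) n = sumℕ (suc n) (λ k → f k ℤ.* g (n ∸ k))

_⊕_ : Series → Series → Series
(f ⊕ g) n = f n ℤ.+ g n

_⊖_ : Series → Series → Series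
(f ⊖ g) n = f n ℤ.- g n

one : Series
one zero    = 1ℤ
one (suc _) = 0ℤ

X⁻^ : ℕ → Series → Series
X⁻^ zero    f         = f
X⁻^ (suc a) f zero    = 0ℤ
X⁻^ (suc a) f (suc n) = X⁻^ a f n

trunc : ℕ → Series → Series
trunc d f n with n ℕ.≤? d
... | yes _ = f n
... | no  _ = 0ℤ

⊛-comm : ∀ f g → f ⊛ g ≗ g ⊛ f
⊛-comm f g n = trans (sumℕ-reverse (suc n) _) (sumℕ-cong (suc n) swap)
  where
  swap : ∀ k → k < suc n → f (n ∸ k) ℤ.* g (n ∸ (n ∸ k)) ≡ g k ℤ.* f (n ∸ k)
  swap k (s≤s k≤n) =
    trans (cong (λ t → f (n ∸ k) ℤ.* g t) (ℕP.m∸[m∸n]≡n k≤n)) (ℤP.*-comm (f (n ∸ k)) (g k))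

⊛-assoc : ∀ f g h → (f ⊛ g) ⊛ h ≗ f ⊛ (g ⊛ h)
⊛-assoc f g h n = begin
  sumℕ (suc n) (λ k → (f ⊛ g) k ℤ.* h (n ∸ k))
    ≡⟨ sumℕ-cong (suc n) (λ k _ → sym (sumℕ-*ʳ (suc k) (h (n ∸ k)) (λ j → f j ℤ.* g (k ∸ j)))) ⟩
  sumℕ (suc n) (λ k → sumℕ (suc k) (λ j → term j k))
    ≡⟨ sumℕ-triangle (suc n) term ⟩
  sumℕ (suc n) (λ j → sumℕ (suc n ∸ j) (λ l → term j (j + l)))
    ≡⟨ sumℕ-cong (suc n) inner ⟩
  sumℕ (suc n) (λ j → f j ℤ.* (g ⊛ h) (n ∸ j))   ∎
  where
  open ≡-Reasoning
  term : ℕ → ℕ → ℤ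
  term j k = (f j ℤ.* g (k ∸ j)) ℤ.* h (n ∸ k)
  inner : ∀ j → j < suc n → sumℕ (suc n ∸ j) (λ l → term j (j + l)) ≡ f j ℤ.* (g ⊛ h) (n ∸ j)
  inner j (s≤s j≤n) = begin
    sumℕ (suc n ∸ j) (λ l → term j (j + l))
      ≡⟨ cong (λ t → sumℕ t (λ l → term j (j + l))) (ℕP.+-∸-assoc 1 j≤n) ⟩
    sumℕ (suc (n ∸ j)) (λ l → term j (j + l))
      ≡⟨ sumℕ-cong (suc (n ∸ j)) (λ l _ → trans (ℤP.*-assoc (f j) _ _)
           (cong₂ (λ a b → f j ℤ.* (g a ℤ.* h b)) (ℕP.m+n∸m≡n j l) (sym (ℕP.∸-+-assoc n j l)))) ⟩
    sumℕ (suc (n ∸ j)) (λ l → f j ℤ.* (g l ℤ.* h (n ∸ j ∸ l)))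
      ≡⟨ sumℕ-*ˡ (suc (n ∸ j)) (f j) _ ⟩
    f j ℤ.* (g ⊛ h) (n ∸ j)   ∎

⊛-distribʳ-⊕ : ∀ f g h → (f ⊕ g) ⊛ h ≗ f ⊛ h ⊕ g ⊛ h
⊛-distribʳ-⊕ f g h n =
  trans (sumℕ-cong (suc n) (λ k _ → ℤP.*-distribʳ-+ (h (n ∸ k)) (f k) (g k))) (sumℕ-+ (suc n) _ _)

⊛-distribʳ-⊖ : ∀ f g h → (f ⊖ g) ⊛ h ≗ f ⊛ h ⊖ g ⊛ h
⊛-distribʳ-⊖ f g h n = begin
  sumℕ (suc n) (λ k → (f k ℤ.- g k) ℤ.* h (n ∸ k))
    ≡⟨ sumℕ-cong (suc n) (λ k _ → distrib (f k) (g k) (h (n ∸ k))) ⟩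
  sumℕ (suc n) (λ k → f k ℤ.* h (n ∸ k) ℤ.+ ℤ.- (g k ℤ.* h (n ∸ k)))
    ≡⟨ sumℕ-+ (suc n) _ _ ⟩
  (f ⊛ h) n ℤ.+ sumℕ (suc n) (λ k → ℤ.- (g k ℤ.* h (n ∸ k)))
    ≡⟨ cong (λ x → (f ⊛ h) n ℤ.+ x) (sumℕ-neg (suc n) (λ k → g k ℤ.* h (n ∸ k))) ⟩
  (f ⊛ h ⊖ g ⊛ h) n   ∎
  where
  open ≡-Reasoning
  distrib : ∀ a b c → (a ℤ.- b) ℤ.* c ≡ a ℤ.* c ℤ.+ ℤ.- (b ℤ.* c)
  distrib = solve-∀

⊛-distribˡ-⊖ : ∀ f g h → f ⊛ (g ⊖ h) ≗ f ⊛ g ⊖ f ⊛ h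
⊛-distribˡ-⊖ f g h n = begin
  (f ⊛ (g ⊖ h)) n        ≡⟨ ⊛-comm f (g ⊖ h) n ⟩
  ((g ⊖ h) ⊛ f) n        ≡⟨ ⊛-distribʳ-⊖ g h f n ⟩
  (g ⊛ f ⊖ h ⊛ f) n      ≡⟨ cong₂ ℤ._-_ (⊛-comm g f n) (⊛-comm h f n) ⟩
  (f ⊛ g ⊖ f ⊛ h) n      ∎
  where open ≡-Reasoning

⊛-identityˡ : ∀ f → one ⊛ f ≗ f
⊛-identityˡ f n = begin
  sumℕ (suc n) (λ k → one k ℤ.* f (n ∸ k))   ≡⟨ sumℕ-head n _ ⟩
  1ℤ ℤ.* f n ℤ.+ sumℕ n (λ _ → 0ℤ)           ≡⟨ cong₂ ℤ._+_ (ℤP.*-identityˡ (f n)) (sumℕ-0 n) ⟩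
  f n ℤ.+ 0ℤ                                 ≡⟨ ℤP.+-identityʳ (f n) ⟩
  f n                                        ∎
  where open ≡-Reasoning

⊛-identityʳ : ∀ f → f ⊛ one ≗ f
⊛-identityʳ f n = trans (⊛-comm f one n) (⊛-identityˡ f n)

⊛-distrib-regroup : ∀ Q A B R → Q ⊛ (one ⊖ A ⊛ B) ⊕ R ⊛ B ≗ Q ⊖ (Q ⊛ A ⊖ R) ⊛ B
⊛-distrib-regroup Q A B R n = begin
  (Q ⊛ (one ⊖ A ⊛ B)) n ℤ.+ (R ⊛ B) n            ≡⟨ cong (ℤ._+ (R ⊛ B) n) (⊛-distribˡ-⊖ Q one (A ⊛ B) n) ⟩
  ((Q ⊛ one) n ℤ.- (Q ⊛ (A ⊛ B)) n) ℤ.+ (R ⊛ B) n ≡⟨ cong₂ (λ x y → (x ℤ.- y) ℤ.+ (R ⊛ B) n) (⊛-identityʳ Q n) (sym (⊛-assoc Q A B n)) ⟩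
  (Q n ℤ.- (Q ⊛ A ⊛ B) n) ℤ.+ (R ⊛ B) n           ≡⟨ move (Q n) ((Q ⊛ A ⊛ B) n) ((R ⊛ B) n) ⟩
  Q n ℤ.- ((Q ⊛ A ⊛ B) n ℤ.- (R ⊛ B) n)           ≡⟨ cong (λ x → Q n ℤ.- x) (sym (⊛-distribʳ-⊖ (Q ⊛ A) R B n)) ⟩
  (Q ⊖ (Q ⊛ A ⊖ R) ⊛ B) n                         ∎
  where
  open ≡-Reasoning
  move : ∀ q x y → (q ℤ.- x) ℤ.+ y ≡ q ℤ.- (x ℤ.- y)
  move = solve-∀

X⁻^-+ : ∀ a f n → X⁻^ a f (a + n) ≡ f n
X⁻^-+ zero    f n = refl
X⁻^-+ (suc a) f n = X⁻^-+ a f n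

X⁻^-< : ∀ a f n → n < a → X⁻^ a f n ≡ 0ℤ
X⁻^-< (suc a) f zero    _         = refl
X⁻^-< (suc a) f (suc n) (s≤s n<a) = X⁻^-< a f n n<a

X⁻^-≥ : ∀ a f n → a ≤ n → X⁻^ a f n ≡ f (n ∸ a)
X⁻^-≥ zero    f n       _         = refl
X⁻^-≥ (suc a) f (suc n) (s≤s a≤n) = X⁻^-≥ a f n a≤n

X⁻^-cong : ∀ a {f g} → f ≗ g → X⁻^ a f ≗ X⁻^ a g
X⁻^-cong zero    f≗g n       = f≗g n
X⁻^-cong (suc a) f≗g zero    = refl
X⁻^-cong (suc a) f≗g (suc n) = X⁻^-cong a f≗g n

X⁻^-X⁻^ : ∀ b a f → X⁻^ b (X⁻^ a f) ≗ X⁻^ (b + a) f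
X⁻^-X⁻^ zero    a f n       = refl
X⁻^-X⁻^ (suc b) a f zero    = refl
X⁻^-X⁻^ (suc b) a f (suc n) = X⁻^-X⁻^ b a f n

X⁻^-⊕ : ∀ a f g → X⁻^ a (f ⊕ g) ≗ X⁻^ a f ⊕ X⁻^ a g
X⁻^-⊕ zero    f g n       = refl
X⁻^-⊕ (suc a) f g zero    = refl
X⁻^-⊕ (suc a) f g (suc n) = X⁻^-⊕ a f g n

X⁻^-⊖ : ∀ a f g → X⁻^ a (f ⊖ g) ≗ X⁻^ a f ⊖ X⁻^ a g
X⁻^-⊖ zero    f g n       = refl
X⁻^-⊖ (suc a) f g zero    = refl
X⁻^-⊖ (suc a) f g (suc n) = X⁻^-⊖ a f g n

X⁻^-⊛ : ∀ a f g → X⁻^ a f ⊛ g ≗ X⁻^ a (f ⊛ g)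
X⁻^-⊛ zero    f g n       = refl
X⁻^-⊛ (suc a) f g zero    = refl
X⁻^-⊛ (suc a) f g (suc n) =
  trans (sumℕ-head (suc n) _) (trans (ℤP.+-identityˡ _) (X⁻^-⊛ a f g n))

⊛-X⁻^ : ∀ a f g → f ⊛ X⁻^ a g ≗ X⁻^ a (f ⊛ g)
⊛-X⁻^ a f g n = begin
  (f ⊛ X⁻^ a g) n      ≡⟨ ⊛-comm f (X⁻^ a g) n ⟩
  (X⁻^ a g ⊛ f) n      ≡⟨ X⁻^-⊛ a g f n ⟩
  X⁻^ a (g ⊛ f) n      ≡⟨ X⁻^-cong a (⊛-comm g f) n ⟩
  X⁻^ a (f ⊛ g) n      ∎
  where open ≡-Reasoning

trunc-≤ : ∀ d f n → n ≤ d → trunc d f n ≡ f n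
trunc-≤ d f n n≤d with n ℕ.≤? d
... | yes _   = refl
... | no  n≰d = contradiction n≤d n≰d

trunc-> : ∀ d f n → d < n → trunc d f n ≡ 0ℤ
trunc-> d f n d<n with n ℕ.≤? d
... | yes n≤d = contradiction d<n (ℕP.≤⇒≯ n≤d)
... | no  _   = refl

atℤ-neg : ∀ c k → 0 < k → atℤ c (ℤ.- + k) ≡ 0ℤ
atℤ-neg c (suc k) _ = refl

atℤ-X⁻^ : ∀ c n a → atℤ c (+ n ℤ.- + a) ≡ X⁻^ a c n
atℤ-X⁻^ c n a with a ℕ.≤? n
... | yes a≤n = trans (cong (atℤ c) (trans (ℤP.m-n≡m⊖n n a) (ℤP.⊖-≥ a≤n))) (sym (X⁻^-≥ a c n a≤n))
... | no  a≰n = begin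
  atℤ c (+ n ℤ.- + a)     ≡⟨ cong (atℤ c) (trans (ℤP.m-n≡m⊖n n a) (ℤP.⊖-< n<a)) ⟩
  atℤ c (ℤ.- + (a ∸ n))   ≡⟨ atℤ-neg c (a ∸ n) (ℕP.m<n⇒0<n∸m n<a) ⟩
  0ℤ                      ≡⟨ sym (X⁻^-< a c n n<a) ⟩
  X⁻^ a c n               ∎
  where
  open ≡-Reasoning
  n<a = ℕP.≰⇒> a≰n

coef-Xpow-*L : ∀ r f → coef (Xpow r *L f) ≗ coef f
coef-Xpow-*L r f n = trans (sumℕ-cong (suc n) (λ k _ → cong (ℤ._* coef f (n ∸ k)) (Xpow≗one k))) (⊛-identityˡ (coef f) n)
  where
  Xpow≗one : coef (Xpow r) ≗ one
  Xpow≗one zero    = refl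
  Xpow≗one (suc _) = refl

coeffAt-oneL : ∀ i → coeffAt oneL i ≡ atℤ one i
coeffAt-oneL (+ zero)    = refl
coeffAt-oneL (+ suc _)   = refl
coeffAt-oneL -[1+ _ ]    = refl

fractionalSeries : ∀ {p} → FpLaurent p → ℕ → Series
fractionalSeries θ r = coef (frac (Xpow r *L toL θ))

fractionalSeries-suc : ∀ {p} (θ : FpLaurent p) r m → fractionalSeries θ r (suc m) ≡ coeffAt (toL θ) (+ (suc m + r))
fractionalSeries-suc θ r m =
  trans (coef-Xpow-*L r (toL θ) (suc m + (r + lshift θ))) (cong (coef (toL θ)) (sym (ℕP.+-assoc (suc m) r (lshift θ))))

coeffAt-frac : ∀ f i → coeffAt (frac f) (+ suc i) ≡ coeffAt f (+ suc i)
coeffAt-frac f i = cong (λ j → coeffAt f (+ suc j)) (ℕP.+-identityʳ i)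

extend : ∀ n → (Fin n → ℤ) → ℕ → ℤ
extend zero    f k       = 0ℤ
extend (suc n) f zero    = f Fin.zero
extend (suc n) f (suc k) = extend n (f ∘ Fin.suc) k

sumFin≡sumℕ-extend : ∀ n f → sumFin n f ≡ sumℕ n (extend n f)
sumFin≡sumℕ-extend zero    f = refl
sumFin≡sumℕ-extend (suc n) f =
  trans (cong (λ t → f Fin.zero ℤ.+ t) (sumFin≡sumℕ-extend n (f ∘ Fin.suc))) (sym (sumℕ-head n (extend (suc n) f)))

extend-* : ∀ n (a : Fin n → ℤ) (g : ℕ → ℤ) → extend n (λ i → a i ℤ.* g (toℕ i)) ≗ λ k → extend n a k ℤ.* g k
extend-* zero    a g k       = refl
extend-* (suc n) a g zero    = refl
extend-* (suc n) a g (suc k) = extend-* n (a ∘ Fin.suc) (g ∘ suc) k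

extend-toℕ : ∀ n f (i : Fin n) → extend n f (toℕ i) ≡ f i
extend-toℕ (suc n) f Fin.zero    = refl
extend-toℕ (suc n) f (Fin.suc i) = extend-toℕ n (f ∘ Fin.suc) i

δ-≡ : ∀ a → δ a a ≡ 1ℤ
δ-≡ a with a ℕ.≟ a
... | yes _   = refl
... | no  a≢a = contradiction refl a≢a

δ-≢ : ∀ a b → a ≢ b → δ a b ≡ 0ℤ
δ-≢ a b a≢b with a ℕ.≟ b
... | yes a≡b = contradiction a≡b a≢b
... | no  _   = refl

module _ {m} (C₁ C₂ C₃ : Mat m) (d₁ d₂ : ℕ) (c : Fin m) where

  stackRow-upper : ∀ i → i < d₁ → stackRow C₁ C₂ C₃ d₁ d₂ i c ≡ C₁ i c
  stackRow-upper i i<d₁ with i ℕ.<? d₁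
  ... | yes _    = refl
  ... | no  i≮d₁ = contradiction i<d₁ i≮d₁

  stackRow-middle : ∀ j → j < d₂ → stackRow C₁ C₂ C₃ d₁ d₂ (d₁ + j) c ≡ C₂ j c
  stackRow-middle j j<d₂ with (d₁ + j) ℕ.<? d₁
  ... | yes d₁+j<d₁ = contradiction d₁+j<d₁ (ℕP.m+n≮m d₁ j)
  ... | no  _ with (d₁ + j) ℕ.<? (d₁ + d₂)
  ...   | yes _ = cong (λ t → C₂ t c) (ℕP.m+n∸m≡n d₁ j)
  ...   | no  ≮ = contradiction (ℕP.+-monoʳ-< d₁ j<d₂) ≮

  stackRow-lower : ∀ j → stackRow C₁ C₂ C₃ d₁ d₂ (d₁ + d₂ + j) c ≡ C₃ j c
  stackRow-lower j with (d₁ + d₂ + j) ℕ.<? d₁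
  ... | yes <d₁ = contradiction (ℕP.≤-trans (ℕP.m≤m+n d₁ d₂) (ℕP.m≤m+n (d₁ + d₂) j)) (ℕP.<⇒≱ <d₁)
  ... | no  _ with (d₁ + d₂ + j) ℕ.<? (d₁ + d₂)
  ...   | yes <d₁+d₂ = contradiction <d₁+d₂ (ℕP.m+n≮m (d₁ + d₂) j)
  ...   | no  _      = cong (λ t → C₃ t c) (ℕP.m+n∸m≡n (d₁ + d₂) j)

module _ (p : ℕ) (p-prime : Prime p) where

  -- Arithmetic modulo p

  infix 4 _≈_ _≉0

  -- A record, so that x and y can be inferred from a proof of x ≈ y.
  record _≈_ (x y : ℤ) : Set where
    constructor mk≈
    field p∣x-y : + p ℤD.∣ (x ℤ.- y)
  open _≈_

  _≉0 : ℤ → Set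
  x ≉0 = ¬ x ≈ 0ℤ

  ≈-refl : ∀ {x} → x ≈ x
  ≈-refl {x} = mk≈ (subst (+ p ℤD.∣_) (sym (ℤP.+-inverseʳ x)) (ℤD.divides 0ℤ refl))

  ≡⇒≈ : ∀ {x y} → x ≡ y → x ≈ y
  ≡⇒≈ refl = ≈-refl

  ≈-sym : ∀ {x y} → x ≈ y → y ≈ x
  ≈-sym {x} {y} (mk≈ d) = mk≈ (subst (+ p ℤD.∣_) (flip x y) (ℤD.∣m⇒∣-m d))
    where
    flip : ∀ x y → ℤ.- (x ℤ.- y) ≡ y ℤ.- x
    flip = solve-∀

  ≈-trans : ∀ {x y z} → x ≈ y → y ≈ z → x ≈ z
  ≈-trans {x} {y} {z} (mk≈ d) (mk≈ e) = mk≈ (subst (+ p ℤD.∣_) (telescope x y z) (ℤD.∣m∣n⇒∣m+n d e))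
    where
    telescope : ∀ x y z → (x ℤ.- y) ℤ.+ (y ℤ.- z) ≡ x ℤ.- z
    telescope = solve-∀

  ≈-setoid : Setoid _ _
  ≈-setoid = record
    { Carrier = ℤ ; _≈_ = _≈_
    ; isEquivalence = record { refl = ≈-refl ; sym = ≈-sym ; trans = ≈-trans } }

  +-cong : ∀ {a b c d} → a ≈ c → b ≈ d → a ℤ.+ b ≈ c ℤ.+ d
  +-cong {a} {b} {c} {d} (mk≈ d₁) (mk≈ d₂) =
    mk≈ (subst (+ p ℤD.∣_) (regroup a b c d) (ℤD.∣m∣n⇒∣m+n d₁ d₂))
    where
    regroup : ∀ a b c d → (a ℤ.- c) ℤ.+ (b ℤ.- d) ≡ (a ℤ.+ b) ℤ.- (c ℤ.+ d)
    regroup = solve-∀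

  *-cong : ∀ {a b c d} → a ≈ c → b ≈ d → a ℤ.* b ≈ c ℤ.* d
  *-cong {a} {b} {c} {d} (mk≈ d₁) (mk≈ d₂) =
    mk≈ (subst (+ p ℤD.∣_) (regroup a b c d) (ℤD.∣m∣n⇒∣m+n (ℤD.∣m⇒∣m*n b d₁) (ℤD.∣n⇒∣m*n c d₂)))
    where
    regroup : ∀ a b c d → (a ℤ.- c) ℤ.* b ℤ.+ c ℤ.* (b ℤ.- d) ≡ a ℤ.* b ℤ.- c ℤ.* d
    regroup = solve-∀

  neg-cong : ∀ {a b} → a ≈ b → ℤ.- a ≈ ℤ.- b
  neg-cong {a} {b} (mk≈ d) = mk≈ (subst (+ p ℤD.∣_) (regroup a b) (ℤD.∣m⇒∣-m d))
    where
    regroup : ∀ a b → ℤ.- (a ℤ.- b) ≡ ℤ.- a ℤ.- ℤ.- b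
    regroup = solve-∀

  p∣⇒≈0 : ∀ {x} → + p ℤD.∣ x → x ≈ 0ℤ
  p∣⇒≈0 {x} d = mk≈ (subst (+ p ℤD.∣_) (sym (ℤP.+-identityʳ x)) d)

  ≈0⇒p∣ : ∀ {x} → x ≈ 0ℤ → + p ℤD.∣ x
  ≈0⇒p∣ {x} (mk≈ d) = subst (+ p ℤD.∣_) (ℤP.+-identityʳ x) d

  isZero⇒≈0 : ∀ {x} → IsZeroₚ p x → x ≈ 0ℤ
  isZero⇒≈0 = p∣⇒≈0 ∘ ℤD.∣ᵤ⇒∣

  ≈0⇒isZero : ∀ {x} → x ≈ 0ℤ → IsZeroₚ p x
  ≈0⇒isZero = ℤD.∣⇒∣ᵤ ∘ ≈0⇒p∣

  ≈⇒≡[p] : ∀ {x y} → x ≈ y → x ≡[ p ] y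
  ≈⇒≡[p] = ℤD.∣⇒∣ᵤ ∘ p∣x-y

  _≈0? : ∀ x → Dec (x ≈ 0ℤ)
  x ≈0? with + p ℤD.∣? x
  ... | yes p∣x = yes (p∣⇒≈0 p∣x)
  ... | no  p∤x = no (p∤x ∘ ≈0⇒p∣)

  x≈0⇒x*y≈0 : ∀ {x} y → x ≈ 0ℤ → x ℤ.* y ≈ 0ℤ
  x≈0⇒x*y≈0 {x} y x≈0 = p∣⇒≈0 (ℤD.∣m⇒∣m*n y (≈0⇒p∣ x≈0))

  y≈0⇒x*y≈0 : ∀ x {y} → y ≈ 0ℤ → x ℤ.* y ≈ 0ℤ
  y≈0⇒x*y≈0 x y≈0 = p∣⇒≈0 (ℤD.∣n⇒∣m*n x (≈0⇒p∣ y≈0))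

  1≉0 : 1ℤ ≉0
  1≉0 1≈0 = ℕ.nonTrivial⇒≢1 {{prime⇒nonTrivial p-prime}} (ℕD.∣1⇒≡1 (ℤD.∣⇒∣ᵤ (≈0⇒p∣ 1≈0)))

  *-≉0 : ∀ {x y} → x ≉0 → y ≉0 → x ℤ.* y ≉0
  *-≉0 {x} {y} x≉0 y≉0 xy≈0
    with euclidsLemma ℤ.∣ x ∣ ℤ.∣ y ∣ p-prime
           (subst (p ℕD.∣_) (ℤP.abs-* x y) (ℤD.∣⇒∣ᵤ (≈0⇒p∣ xy≈0)))
  ... | inj₁ p∣x = x≉0 (isZero⇒≈0 p∣x)
  ... | inj₂ p∣y = y≉0 (isZero⇒≈0 p∣y)

  private
    coprime-to-p : ∀ n → ¬ (p ℕD.∣ n) → Coprime p n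
    coprime-to-p n p∤n (d∣p , d∣n) with prime⇒irreducible p-prime d∣p
    ... | inj₁ d≡1 = d≡1
    ... | inj₂ refl = contradiction d∣n p∤n

    cast : ∀ u v w z → u ℕ.+ v ℕ.* w ≡ z → + u ℤ.+ + v ℤ.* + w ≡ + z
    cast u v w z eq = begin
      + u ℤ.+ + v ℤ.* + w     ≡⟨ cong (λ t → + u ℤ.+ t) (sym (ℤP.pos-* v w)) ⟩
      + u ℤ.+ + (v ℕ.* w)     ≡⟨ sym (ℤP.pos-+ u (v ℕ.* w)) ⟩
      + (u ℕ.+ v ℕ.* w)       ≡⟨ cong +_ eq ⟩
      + z                     ∎
      where open ≡-Reasoning

    inverseℕ : ∀ n → ¬ (p ℕD.∣ n) → ∃[ c ] + n ℤ.* c ≈ 1ℤ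
    inverseℕ n p∤n with coprime-Bézout (coprime-to-p n p∤n)
    ... | Bézout.+- x y eq = ℤ.- + y , mk≈ (ℤD.divides (ℤ.- + x) (begin
            + n ℤ.* ℤ.- + y ℤ.- 1ℤ           ≡⟨ negate (+ n) (+ y) ⟩
            ℤ.- (1ℤ ℤ.+ + y ℤ.* + n)         ≡⟨ cong ℤ.-_ (trans (cast 1 y n _ eq) (ℤP.pos-* x p)) ⟩
            ℤ.- (+ x ℤ.* + p)                ≡⟨ ℤP.neg-distribˡ-* (+ x) (+ p) ⟩
            ℤ.- + x ℤ.* + p                  ∎))
      where
      open ≡-Reasoning
      negate : ∀ a b → a ℤ.* ℤ.- b ℤ.- 1ℤ ≡ ℤ.- (1ℤ ℤ.+ b ℤ.* a)
      negate = solve-∀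
    ... | Bézout.-+ x y eq = + y , mk≈ (ℤD.divides (+ x) (begin
            + n ℤ.* + y ℤ.- 1ℤ               ≡⟨ cong (ℤ._- 1ℤ) (ℤP.*-comm (+ n) (+ y)) ⟩
            + y ℤ.* + n ℤ.- 1ℤ               ≡⟨ cong (ℤ._- 1ℤ) (sym (trans (cast 1 x p _ eq) (ℤP.pos-* y n))) ⟩
            (1ℤ ℤ.+ + x ℤ.* + p) ℤ.- 1ℤ      ≡⟨ cancel (+ x ℤ.* + p) ⟩
            + x ℤ.* + p                      ∎))
      where
      open ≡-Reasoning
      cancel : ∀ a → (1ℤ ℤ.+ a) ℤ.- 1ℤ ≡ a
      cancel = solve-∀

  inverse : ∀ x → x ≉0 → ∃[ c ] x ℤ.* c ≈ 1ℤ
  inverse (+ n)      x≉0 = inverseℕ n (x≉0 ∘ isZero⇒≈0)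
  inverse -[1+ m ]   x≉0 with inverseℕ (suc m) (x≉0 ∘ isZero⇒≈0)
  ... | c , nc≈1 = ℤ.- c , ≈-trans (≡⇒≈ (neg*neg (+ suc m) c)) nc≈1
    where
    neg*neg : ∀ a c → ℤ.- a ℤ.* ℤ.- c ≡ a ℤ.* c
    neg*neg = solve-∀

  infix 4 _≋_
  _≋_ : Series → Series → Set
  f ≋ g = ∀ n → f n ≈ g n

  ≋-refl : ∀ {f} → f ≋ f
  ≋-refl _ = ≈-refl

  ≋-trans : ∀ {f g h} → f ≋ g → g ≋ h → f ≋ h
  ≋-trans f≋g g≋h n = ≈-trans (f≋g n) (g≋h n)

  ≋-setoid : Setoid _ _
  ≋-setoid = record
    { Carrier = Series ; _≈_ = _≋_
    ; isEquivalence = record { refl = ≋-refl ; sym = λ f≋g n → ≈-sym (f≋g n) ; trans = ≋-trans } }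

  ≗⇒≋ : ∀ {f g} → f ≗ g → f ≋ g
  ≗⇒≋ f≗g n = ≡⇒≈ (f≗g n)

  sumℕ-≈ : ∀ n {f g : ℕ → ℤ} → (∀ k → k < n → f k ≈ g k) → sumℕ n f ≈ sumℕ n g
  sumℕ-≈ zero    f≈g = ≈-refl
  sumℕ-≈ (suc n) f≈g = +-cong (sumℕ-≈ n (λ k k<n → f≈g k (ℕP.m<n⇒m<1+n k<n))) (f≈g n ℕP.≤-refl)

  sumℕ-≈0 : ∀ n {f : ℕ → ℤ} → (∀ k → k < n → f k ≈ 0ℤ) → sumℕ n f ≈ 0ℤ
  sumℕ-≈0 n f≈0 = ≈-trans (sumℕ-≈ n f≈0) (≡⇒≈ (sumℕ-0 n))

  sumℕ-single : ∀ n {f : ℕ → ℤ} i → i < n → (∀ k → k < n → k ≢ i → f k ≈ 0ℤ) → sumℕ n f ≈ f i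
  sumℕ-single (suc n) {f} i i<1+n others with i ℕ.≟ n
  ... | yes refl = ≈-trans (+-cong (sumℕ-≈0 n (λ k k<n → others k (ℕP.m<n⇒m<1+n k<n) (ℕP.<⇒≢ k<n))) ≈-refl)
                           (≡⇒≈ (ℤP.+-identityˡ (f i)))
  ... | no  i≢n  = ≈-trans (+-cong (sumℕ-single n i (ℕP.≤∧≢⇒< (ℕP.≤-pred i<1+n) i≢n)
                                     (λ k k<n → others k (ℕP.m<n⇒m<1+n k<n)))
                                   (others n ℕP.≤-refl (i≢n ∘ sym)))
                           (≡⇒≈ (ℤP.+-identityʳ (f i)))

  sumℕ-prefix : ∀ m n (f : ℕ → ℤ) → (∀ j → j < n → f (m + j) ≈ 0ℤ) → sumℕ (m + n) f ≈ sumℕ m f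
  sumℕ-prefix m n f tail≈0 = begin
    sumℕ (m + n) f                              ≡⟨ sumℕ-split m n f ⟩
    sumℕ m f ℤ.+ sumℕ n (λ j → f (m + j))       ≈⟨ +-cong (≈-refl {sumℕ m f}) (sumℕ-≈0 n tail≈0) ⟩
    sumℕ m f ℤ.+ 0ℤ                             ≡⟨ ℤP.+-identityʳ (sumℕ m f) ⟩
    sumℕ m f                                    ∎
    where open SetoidReasoning ≈-setoid

  ⊛-cong : ∀ {f f′ g g′} → f ≋ f′ → g ≋ g′ → f ⊛ g ≋ f′ ⊛ g′
  ⊛-cong f≋f′ g≋g′ n = sumℕ-≈ (suc n) (λ k _ → *-cong (f≋f′ k) (g≋g′ (n ∸ k)))

  ⊕-cong : ∀ {f f′ g g′} → f ≋ f′ → g ≋ g′ → f ⊕ g ≋ f′ ⊕ g′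
  ⊕-cong f≋f′ g≋g′ n = +-cong (f≋f′ n) (g≋g′ n)

  ⊖-cong : ∀ {f f′ g g′} → f ≋ f′ → g ≋ g′ → f ⊖ g ≋ f′ ⊖ g′
  ⊖-cong f≋f′ g≋g′ n = +-cong (f≋f′ n) (neg-cong (g≋g′ n))

  X⁻^-≋ : ∀ a {f g} → f ≋ g → X⁻^ a f ≋ X⁻^ a g
  X⁻^-≋ zero    f≋g n       = f≋g n
  X⁻^-≋ (suc a) f≋g zero    = ≈-refl
  X⁻^-≋ (suc a) f≋g (suc n) = X⁻^-≋ a f≋g n

  trunc-≈0 : ∀ d f n → f n ≈ 0ℤ → trunc d f n ≈ 0ℤ
  trunc-≈0 d f n fn≈0 with n ℕ.≤? d
  ... | yes _ = fn≈0
  ... | no  _ = ≈-refl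

  VanishesBelow : ℕ → Series → Set
  VanishesBelow a f = ∀ k → k < a → f k ≈ 0ℤ

  VanishesAbove : ℕ → Series → Set
  VanishesAbove d f = ∀ k → d < k → f k ≈ 0ℤ

  vanishesBelow-0 : ∀ f → VanishesBelow 0 f
  vanishesBelow-0 f k ()

  trunc-vanishesAbove : ∀ d f → VanishesAbove d (trunc d f)
  trunc-vanishesAbove d f k d<k = ≡⇒≈ (trunc-> d f k d<k)

  ⊕-vanishesAbove : ∀ {d f g} → VanishesAbove d f → VanishesAbove d g → VanishesAbove d (f ⊕ g)
  ⊕-vanishesAbove f>d g>d k d<k = +-cong (f>d k d<k) (g>d k d<k)

  trunc-vanishesBelow : ∀ a d {f} → VanishesBelow a f → VanishesBelow a (trunc d f)
  trunc-vanishesBelow a d {f} f<a k k<a = trunc-≈0 d f k (f<a k k<a)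

  X⁻^-vanishesAbove : ∀ a {d f} → VanishesAbove d f → VanishesAbove (a + d) (X⁻^ a f)
  X⁻^-vanishesAbove zero    f>d k       d<k       = f>d k d<k
  X⁻^-vanishesAbove (suc a) f>d (suc k) (s≤s a+d<k) = X⁻^-vanishesAbove a f>d k a+d<k

  vanishesBelow⇒≋X⁻^ : ∀ a {f} → VanishesBelow a f → f ≋ X⁻^ a (λ n → f (a + n))
  vanishesBelow⇒≋X⁻^ a {f} f<a n with n ℕ.<? a
  ... | yes n<a = ≈-trans (f<a n n<a) (≡⇒≈ (sym (X⁻^-< a _ n n<a)))
  ... | no  n≮a = ≡⇒≈ (sym (trans (X⁻^-≥ a _ n a≤n) (cong f (ℕP.m+[n∸m]≡n a≤n))))
    where a≤n = ℕP.≮⇒≥ n≮a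

  ⊛-vanishesBelow : ∀ a b {f g} → VanishesBelow a f → VanishesBelow b g → VanishesBelow (a + b) (f ⊛ g)
  ⊛-vanishesBelow a b {f} {g} f<a g<b n n<a+b = sumℕ-≈0 (suc n) term≈0
    where
    term≈0 : ∀ k → k < suc n → f k ℤ.* g (n ∸ k) ≈ 0ℤ
    term≈0 k (s≤s k≤n) with k ℕ.<? a
    ... | yes k<a = x≈0⇒x*y≈0 _ (f<a k k<a)
    ... | no  k≮a = y≈0⇒x*y≈0 (f k) (g<b (n ∸ k) (ℕP.+-cancelˡ-< k (n ∸ k) b
                      (subst (_< k + b) (sym (ℕP.m+[n∸m]≡n k≤n))
                        (ℕP.<-≤-trans n<a+b (ℕP.+-monoˡ-≤ b (ℕP.≮⇒≥ k≮a))))))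

  ⊛-vanishesAbove : ∀ d e {f g} → VanishesAbove d f → VanishesAbove e g → VanishesAbove (d + e) (f ⊛ g)
  ⊛-vanishesAbove d e {f} {g} f>d g>e n d+e<n = sumℕ-≈0 (suc n) term≈0
    where
    term≈0 : ∀ k → k < suc n → f k ℤ.* g (n ∸ k) ≈ 0ℤ
    term≈0 k (s≤s k≤n) with d ℕ.<? k
    ... | yes d<k = x≈0⇒x*y≈0 _ (f>d k d<k)
    ... | no  d≮k = y≈0⇒x*y≈0 (f k) (g>e (n ∸ k) (ℕP.+-cancelˡ-< k e (n ∸ k)
                      (subst (k + e <_) (sym (ℕP.m+[n∸m]≡n k≤n))
                        (ℕP.≤-<-trans (ℕP.+-monoˡ-≤ e (ℕP.≮⇒≥ d≮k)) d+e<n))))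

  ⊛-leading : ∀ a b {f g} → VanishesBelow a f → VanishesBelow b g → (f ⊛ g) (a + b) ≈ f a ℤ.* g b
  ⊛-leading a b {f} {g} f<a g<b =
    ≈-trans (sumℕ-single (suc (a + b)) a (s≤s (ℕP.m≤m+n a b)) others)
            (≡⇒≈ (cong (λ x → f a ℤ.* g x) (ℕP.m+n∸m≡n a b)))
    where
    others : ∀ k → k < suc (a + b) → k ≢ a → f k ℤ.* g (a + b ∸ k) ≈ 0ℤ
    others k (s≤s k≤a+b) k≢a with k ℕ.<? a
    ... | yes k<a = x≈0⇒x*y≈0 _ (f<a k k<a)
    ... | no  k≮a = y≈0⇒x*y≈0 (f k) (g<b (a + b ∸ k) (ℕP.+-cancelˡ-< k (a + b ∸ k) b
                      (subst (_< k + b) (sym (ℕP.m+[n∸m]≡n k≤a+b))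
                        (ℕP.+-monoˡ-< b (ℕP.≤∧≢⇒< (ℕP.≮⇒≥ k≮a) (k≢a ∘ sym))))))

  ⊛-inverse : ∀ σ → σ 0 ≉0 → Σ Series (λ τ → σ ⊛ τ ≋ one)
  ⊛-inverse σ σ₀≉0 = τ , σ⊛τ≋one
    where
    c : ℤ
    c = proj₁ (inverse (σ 0) σ₀≉0)
    σ₀c≈1 : σ 0 ℤ.* c ≈ 1ℤ
    σ₀c≈1 = proj₂ (inverse (σ 0) σ₀≉0)
    -- table n k = τ (n ∸ k) for k ≤ n; tabulating the solved-for coefficients makes the recursion structural.
    table : ℕ → ℕ → ℤ
    table zero    _       = c
    table (suc n) zero    = ℤ.- (c ℤ.* sumℕ (suc n) (λ k → σ (suc k) ℤ.* table n k))
    table (suc n) (suc k) = table n k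
    τ : Series
    τ n = table n 0
    table≡τ : ∀ n k → k ≤ n → table n k ≡ τ (n ∸ k)
    table≡τ n       zero    _         = refl
    table≡τ (suc n) (suc k) (s≤s k≤n) = table≡τ n k k≤n
    σ⊛τ≋one : σ ⊛ τ ≋ one
    σ⊛τ≋one zero    = ≈-trans (≡⇒≈ (ℤP.+-identityˡ _)) σ₀c≈1
    σ⊛τ≋one (suc n) = begin
      (σ ⊛ τ) (suc n)                           ≡⟨ sumℕ-head (suc n) (λ k → σ k ℤ.* τ (suc n ∸ k)) ⟩
      σ 0 ℤ.* τ (suc n) ℤ.+ S                   ≡⟨ cong (λ t → σ 0 ℤ.* ℤ.- (c ℤ.* t) ℤ.+ S) table-sum ⟩
      σ 0 ℤ.* ℤ.- (c ℤ.* S) ℤ.+ S               ≡⟨ regroup (σ 0) c S ⟩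
      ℤ.- (σ 0 ℤ.* c ℤ.* S) ℤ.+ S               ≈⟨ +-cong (neg-cong (*-cong σ₀c≈1 (≈-refl {S}))) ≈-refl ⟩
      ℤ.- (1ℤ ℤ.* S) ℤ.+ S                      ≡⟨ cancel S ⟩
      0ℤ                                        ∎
      where
      open SetoidReasoning ≈-setoid
      S : ℤ
      S = sumℕ (suc n) (λ k → σ (suc k) ℤ.* τ (n ∸ k))
      table-sum : sumℕ (suc n) (λ k → σ (suc k) ℤ.* table n k) ≡ S
      table-sum = sumℕ-cong (suc n) (λ k k<1+n → cong (σ (suc k) ℤ.*_) (table≡τ n k (ℕP.≤-pred k<1+n)))
      regroup : ∀ x y z → x ℤ.* ℤ.- (y ℤ.* z) ℤ.+ z ≡ ℤ.- (x ℤ.* y ℤ.* z) ℤ.+ z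
      regroup = solve-∀
      cancel : ∀ z → ℤ.- (1ℤ ℤ.* z) ℤ.+ z ≡ 0ℤ
      cancel = solve-∀

  ⊛≋one⇒≉0 : ∀ {σ τ} → σ ⊛ τ ≋ one → τ 0 ≉0
  ⊛≋one⇒≉0 {σ} {τ} σ⊛τ≋one τ₀≈0 =
    1≉0 (≈-trans (≈-sym (σ⊛τ≋one 0)) (≈-trans (≡⇒≈ (ℤP.+-identityˡ _)) (y≈0⇒x*y≈0 (σ 0) τ₀≈0)))

  private instance
    p-nonZero : ℕ.NonZero p
    p-nonZero = prime⇒nonZero p-prime

  toFin : ℤ → Fin p
  toFin x = fromℕ< (ℤDM.n%ℕd<d x p)

  toFin-≈ : ∀ x → + toℕ (toFin x) ≈ x
  toFin-≈ x = mk≈ (ℤD.divides (ℤ.- (x ℤDM./ℕ p)) (begin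
    + toℕ (toFin x) ℤ.- x                                  ≡⟨ cong₂ ℤ._-_ (cong +_ (FinP.toℕ-fromℕ< (ℤDM.n%ℕd<d x p)))
                                                                          (ℤDM.a≡a%ℕn+[a/ℕn]*n x p) ⟩
    + (x ℤDM.%ℕ p) ℤ.- (+ (x ℤDM.%ℕ p) ℤ.+ (x ℤDM./ℕ p) ℤ.* + p) ≡⟨ cancel (+ (x ℤDM.%ℕ p)) (x ℤDM./ℕ p) (+ p) ⟩
    ℤ.- (x ℤDM./ℕ p) ℤ.* + p                               ∎))
    where
    open ≡-Reasoning
    cancel : ∀ r q n → r ℤ.- (r ℤ.+ q ℤ.* n) ≡ ℤ.- q ℤ.* n
    cancel = solve-∀

  coefficientsOf : ℕ → Series → ℕ → Fin p
  coefficientsOf d Q l = toFin (Q (d ∸ l))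

  coef-poly : ∀ d Q → VanishesAbove d Q → coef (poly p d (coefficientsOf d Q)) ≋ Q
  coef-poly d Q Q>d k with k ℕ.≤? d
  ... | yes k≤d = ≈-trans (toFin-≈ (Q (d ∸ (d ∸ k)))) (≡⇒≈ (cong Q (ℕP.m∸[m∸n]≡n k≤d)))
  ... | no  k≰d = ≈-sym (Q>d k (ℕP.≰⇒> k≰d))

  ⊛-fractional-shift : ∀ d {Q} g h c → VanishesAbove d Q → (∀ m → h (suc m) ≡ g (suc m + c)) →
                       ∀ i → (Q ⊛ g) (suc (d + i) + c) ≈ (Q ⊛ h) (suc (d + i))
  ⊛-fractional-shift d {Q} g h c Q>d h≡g i = begin
    sumℕ (suc (suc (d + i) + c)) G     ≡⟨ cong (λ n → sumℕ n G) (reindex d i c) ⟩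
    sumℕ (suc d + suc (i + c)) G       ≈⟨ sumℕ-prefix (suc d) (suc (i + c)) G (λ j _ → x≈0⇒x*y≈0 _ (Q>d (suc d + j) (s≤s (ℕP.m≤m+n d j)))) ⟩
    sumℕ (suc d) G                     ≈⟨ sumℕ-≈ (suc d) G≈H ⟩
    sumℕ (suc d) H                     ≈⟨ ≈-sym (sumℕ-prefix (suc d) (suc i) H (λ j _ → x≈0⇒x*y≈0 _ (Q>d (suc d + j) (s≤s (ℕP.m≤m+n d j))))) ⟩
    sumℕ (suc d + suc i) H             ≡⟨ cong (λ n → sumℕ n H) (ℕP.+-suc (suc d) i) ⟩
    (Q ⊛ h) (suc (d + i))              ∎
    where
    open SetoidReasoning ≈-setoid
    G H : ℕ → ℤ
    G j = Q j ℤ.* g (suc (d + i) + c ∸ j)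
    H j = Q j ℤ.* h (suc (d + i) ∸ j)
    reindex : ∀ d i c → suc (suc (d + i) + c) ≡ suc d + suc (i + c)
    reindex = ℕSolver.solve-∀
    G≈H : ∀ j → j < suc d → G j ≈ H j
    G≈H j (s≤s j≤d) = *-cong (≈-refl {Q j}) (begin
      g (suc (d + i) + c ∸ j)      ≡⟨ cong g (ℕP.+-∸-comm c (ℕP.m≤n⇒m≤1+n (ℕP.≤-trans j≤d (ℕP.m≤m+n d i)))) ⟩
      g (suc (d + i) ∸ j + c)      ≡⟨ cong (λ t → g (t + c)) (suc[d+i]∸j d i j≤d) ⟩
      g (suc (d ∸ j + i) + c)      ≡⟨ sym (h≡g (d ∸ j + i)) ⟩
      h (suc (d ∸ j + i))          ≡⟨ cong h (sym (suc[d+i]∸j d i j≤d)) ⟩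
      h (suc (d + i) ∸ j)          ∎)

  coefficientsOf-leading : ∀ d Q → Q 0 ≉0 → toℕ (coefficientsOf d Q d) ≢ 0
  coefficientsOf-leading d Q Q₀≉0 toℕ≡0 = Q₀≉0 (begin
    Q 0                           ≡⟨ cong Q (sym (ℕP.n∸n≡0 d)) ⟩
    Q (d ∸ d)                     ≈⟨ ≈-sym (toFin-≈ (Q (d ∸ d))) ⟩
    + toℕ (coefficientsOf d Q d)  ≡⟨ cong +_ toℕ≡0 ⟩
    0ℤ                            ∎)
    where open SetoidReasoning ≈-setoid

  fractional⇒≈frac : ∀ s → s 0 ≈ 0ℤ → ∀ i → coeffAt (mk 0 s) i ≈ coeffAt (frac (mk 0 s)) i
  fractional⇒≈frac s s₀≈0 (+ zero)   = s₀≈0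
  fractional⇒≈frac s s₀≈0 (+ suc n)  = ≡⇒≈ (sym (coeffAt-frac (mk 0 s) n))
  fractional⇒≈frac s s₀≈0 -[1+ n ]   = ≈-refl

  -- coef f n is the coefficient of X^(shift f - n), so the hypothesis says that f = 1.
  ≋X⁻^one⇒≈oneL : ∀ f → coef f ≋ X⁻^ (shift f) one → ∀ i → coeffAt f i ≈ coeffAt oneL i
  ≋X⁻^one⇒≈oneL f f≋ (+ n) = begin
    coef f (n + a)              ≈⟨ f≋ (n + a) ⟩
    X⁻^ a one (n + a)           ≡⟨ cong (X⁻^ a one) (ℕP.+-comm n a) ⟩
    X⁻^ a one (a + n)           ≡⟨ X⁻^-+ a one n ⟩
    one n                       ≡⟨ sym (coeffAt-oneL (+ n)) ⟩
    coeffAt oneL (+ n)          ∎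
    where
    open SetoidReasoning ≈-setoid
    a = shift f
  ≋X⁻^one⇒≈oneL f f≋ -[1+ t ] = begin
    atℤ (coef f) (-[1+ t ] ℤ.+ + a)   ≡⟨ cong (atℤ (coef f)) (reorder (+ a) (+ suc t)) ⟩
    atℤ (coef f) (+ a ℤ.- + suc t)    ≡⟨ atℤ-X⁻^ (coef f) a (suc t) ⟩
    X⁻^ (suc t) (coef f) a             ≈⟨ X⁻^-≋ (suc t) f≋ a ⟩
    X⁻^ (suc t) (X⁻^ a one) a          ≡⟨ X⁻^-X⁻^ (suc t) a one a ⟩
    X⁻^ (suc t + a) one a              ≡⟨ X⁻^-< (suc t + a) one a (s≤s (ℕP.m≤n+m a t)) ⟩
    0ℤ                                 ∎
    where
    open SetoidReasoning ≈-setoid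
    a = shift f
    reorder : ∀ x y → ℤ.- y ℤ.+ x ≡ x ℤ.- y
    reorder = solve-∀

  -- Partial quotients

  record HasDegree (d : ℕ) (Q : Series) : Set where
    field
      vanishesAbove : VanishesAbove d Q
      leading≉0     : Q 0 ≉0

  -- ‖Q s‖ < 2^(-(d+K)), that is |Q|·‖Q s‖ < 2^(-K) for Q of degree d.
  Approximates : ℕ → ℕ → Series → Series → Set
  Approximates K d Q s = ∀ i → i < d + K → (Q ⊛ s) (suc (d + i)) ≈ 0ℤ

  BadlyApproximableAt : ℕ → Series → ℕ → Set
  BadlyApproximableAt K s d = ∀ Q → HasDegree d Q → ¬ Approximates K d Q s

  BadlyApproximable : ℕ → Series → Set
  BadlyApproximable K s = ∀ d → BadlyApproximableAt K s d

  fractionalPart-vanishesBelow : ∀ m d T → (∀ i → i < m → T (suc (d + i)) ≈ 0ℤ) →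
                                 VanishesBelow (suc (d + m)) (T ⊖ trunc d T)
  fractionalPart-vanishesBelow m d T small j j<1+d+m with j ℕ.≤? d
  ... | yes _   = ≡⇒≈ (ℤP.+-inverseʳ (T j))
  ... | no  j≰d with ℕP.m≤n⇒∃[o]m+o≡n (ℕP.≰⇒> j≰d)
  ...   | i , refl = ≈-trans (≡⇒≈ (ℤP.+-identityʳ (T j))) (small i (ℕP.+-cancelˡ-< (suc d) i m j<1+d+m))

  -- Stored as a successor, so that shifts such as order ⊔ 0 in _+L_ reduce.
  record PositiveOrder (s : Series) : Set where
    field
      pred-order  : ℕ
      below-order : VanishesBelow (suc pred-order) s
      at-order≉0  : s (suc pred-order) ≉0

    order : ℕ
    order = suc pred-order

    order>0 : 0 < order
    order>0 = s≤s z≤n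

  -- s = X^(-a) σ with σ 0 ≉ 0, so 1/s = X^a τ for τ = 1/σ.  The partial quotient ⌊1/s⌋ = Σ_{n≤a} τ n X^(a-n)
  -- is `quotient` (stored from the top), and the fractional part {1/s} has τ (a + i) at X^(-i).
  module PartialQuotient {s : Series} (o : PositiveOrder s) where
    open PositiveOrder o renaming (order to a)

    σ : Series
    σ n = s (a + n)

    σ₀≉0 : σ 0 ≉0
    σ₀≉0 = subst (λ t → s t ≉0) (sym (ℕP.+-identityʳ a)) at-order≉0

    τ : Series
    τ = proj₁ (⊛-inverse σ σ₀≉0)

    σ⊛τ≋one : σ ⊛ τ ≋ one
    σ⊛τ≋one = proj₂ (⊛-inverse σ σ₀≉0)

    quotient : Series
    quotient = trunc a τ

    remainder : Series
    remainder zero    = 0ℤ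
    remainder (suc i) = τ (a + suc i)

    quotient-degree : HasDegree a quotient
    quotient-degree = record
      { vanishesAbove = trunc-vanishesAbove a τ
      ; leading≉0     = subst _≉0 (sym (trunc-≤ a τ 0 z≤n)) (⊛≋one⇒≉0 {σ} {τ} σ⊛τ≋one) }

    s≋X⁻^σ : s ≋ X⁻^ a σ
    s≋X⁻^σ = vanishesBelow⇒≋X⁻^ a below-order

    X⁻^remainder-≤ : ∀ n → n ≤ a → X⁻^ a remainder n ≡ 0ℤ
    X⁻^remainder-≤ n n≤a with ℕP.m≤n⇒m<n∨m≡n n≤a
    ... | inj₁ n<a  = X⁻^-< a remainder n n<a
    ... | inj₂ refl = trans (cong (X⁻^ a remainder) (sym (ℕP.+-identityʳ n))) (X⁻^-+ n remainder 0)

    X⁻^remainder-> : ∀ i → X⁻^ a remainder (suc a + i) ≡ τ (suc a + i)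
    X⁻^remainder-> i = begin
      X⁻^ a remainder (suc a + i)     ≡⟨ cong (X⁻^ a remainder) (sym (ℕP.+-suc a i)) ⟩
      X⁻^ a remainder (a + suc i)     ≡⟨ X⁻^-+ a remainder (suc i) ⟩
      τ (a + suc i)                   ≡⟨ cong τ (ℕP.+-suc a i) ⟩
      τ (suc a + i)                   ∎
      where open ≡-Reasoning

    quotient≗τ⊖X⁻^remainder : quotient ≗ τ ⊖ X⁻^ a remainder
    quotient≗τ⊖X⁻^remainder n with n ℕ.≤? a
    ... | yes n≤a = sym (trans (cong (λ t → τ n ℤ.- t) (X⁻^remainder-≤ n n≤a)) (ℤP.+-identityʳ (τ n)))
    ... | no  n≰a with ℕP.m≤n⇒∃[o]m+o≡n (ℕP.≰⇒> n≰a)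
    ...   | i , refl = sym (trans (cong (λ t → τ n ℤ.- t) (X⁻^remainder-> i)) (ℤP.+-inverseʳ (τ n)))

    X⁻^remainder≋τ⊖quotient : X⁻^ a remainder ≋ τ ⊖ quotient
    X⁻^remainder≋τ⊖quotient n = ≡⇒≈ (begin
      X⁻^ a remainder n                       ≡⟨ sym (cancel (τ n) (X⁻^ a remainder n)) ⟩
      τ n ℤ.- (τ n ℤ.- X⁻^ a remainder n)     ≡⟨ cong (λ t → τ n ℤ.- t) (sym (quotient≗τ⊖X⁻^remainder n)) ⟩
      τ n ℤ.- quotient n                      ∎)
      where
      open ≡-Reasoning
      cancel : ∀ t y → t ℤ.- (t ℤ.- y) ≡ y
      cancel = solve-∀

    s⊛τ≋X⁻^one : s ⊛ τ ≋ X⁻^ a one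
    s⊛τ≋X⁻^one = begin
      s ⊛ τ              ≈⟨ ⊛-cong s≋X⁻^σ (≋-refl {τ}) ⟩
      X⁻^ a σ ⊛ τ        ≈⟨ ≗⇒≋ (X⁻^-⊛ a σ τ) ⟩
      X⁻^ a (σ ⊛ τ)      ≈⟨ X⁻^-≋ a σ⊛τ≋one ⟩
      X⁻^ a one          ∎
      where open SetoidReasoning ≋-setoid

    quotient⊛s : quotient ⊛ s ≋ X⁻^ a (one ⊖ remainder ⊛ s)
    quotient⊛s = begin
      quotient ⊛ s                              ≈⟨ ⊛-cong (≗⇒≋ quotient≗τ⊖X⁻^remainder) (≋-refl {s}) ⟩
      (τ ⊖ X⁻^ a remainder) ⊛ s                 ≈⟨ ≗⇒≋ (⊛-distribʳ-⊖ τ (X⁻^ a remainder) s) ⟩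
      τ ⊛ s ⊖ X⁻^ a remainder ⊛ s               ≈⟨ ⊖-cong (≋-trans (≗⇒≋ (⊛-comm τ s)) s⊛τ≋X⁻^one)
                                                             (≗⇒≋ (X⁻^-⊛ a remainder s)) ⟩
      X⁻^ a one ⊖ X⁻^ a (remainder ⊛ s)         ≈⟨ ≗⇒≋ (λ n → sym (X⁻^-⊖ a one (remainder ⊛ s) n)) ⟩
      X⁻^ a (one ⊖ remainder ⊛ s)               ∎
      where open SetoidReasoning ≋-setoid

    ⊛s⊛τ : ∀ Q → Q ⊛ s ⊛ τ ≋ X⁻^ a Q
    ⊛s⊛τ Q = begin
      Q ⊛ s ⊛ τ              ≈⟨ ≗⇒≋ (⊛-assoc Q s τ) ⟩
      Q ⊛ (s ⊛ τ)            ≈⟨ ⊛-cong (≋-refl {Q}) s⊛τ≋X⁻^one ⟩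
      Q ⊛ X⁻^ a one          ≈⟨ ≗⇒≋ (⊛-X⁻^ a Q one) ⟩
      X⁻^ a (Q ⊛ one)        ≈⟨ ≗⇒≋ (X⁻^-cong a (⊛-identityʳ Q)) ⟩
      X⁻^ a Q                ∎
      where open SetoidReasoning ≋-setoid

    -- P = Q ⌊1/s⌋ + R satisfies P s = Q − (Q s′ − R) s, because ⌊1/s⌋ s = 1 − s′ s for the remainder s′.
    lift-identity : ∀ Q R → (Q ⊛ quotient ⊕ X⁻^ a R) ⊛ s ≋ X⁻^ a (Q ⊖ (Q ⊛ remainder ⊖ R) ⊛ s)
    lift-identity Q R = begin
      (Q ⊛ quotient ⊕ X⁻^ a R) ⊛ s                         ≈⟨ ≗⇒≋ (⊛-distribʳ-⊕ (Q ⊛ quotient) (X⁻^ a R) s) ⟩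
      Q ⊛ quotient ⊛ s ⊕ X⁻^ a R ⊛ s                       ≈⟨ ⊕-cong (≗⇒≋ (⊛-assoc Q quotient s)) (≗⇒≋ (X⁻^-⊛ a R s)) ⟩
      Q ⊛ (quotient ⊛ s) ⊕ X⁻^ a (R ⊛ s)                   ≈⟨ ⊕-cong (⊛-cong (≋-refl {Q}) quotient⊛s) (≋-refl {X⁻^ a (R ⊛ s)}) ⟩
      Q ⊛ X⁻^ a (one ⊖ remainder ⊛ s) ⊕ X⁻^ a (R ⊛ s)      ≈⟨ ⊕-cong (≗⇒≋ (⊛-X⁻^ a Q (one ⊖ remainder ⊛ s))) (≋-refl {X⁻^ a (R ⊛ s)}) ⟩
      X⁻^ a (Q ⊛ (one ⊖ remainder ⊛ s)) ⊕ X⁻^ a (R ⊛ s)    ≈⟨ ≗⇒≋ (λ n → sym (X⁻^-⊕ a (Q ⊛ (one ⊖ remainder ⊛ s)) (R ⊛ s) n)) ⟩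
      X⁻^ a (Q ⊛ (one ⊖ remainder ⊛ s) ⊕ R ⊛ s)            ≈⟨ ≗⇒≋ (X⁻^-cong a (⊛-distrib-regroup Q remainder s R)) ⟩
      X⁻^ a (Q ⊖ (Q ⊛ remainder ⊖ R) ⊛ s)                  ∎
      where open SetoidReasoning ≋-setoid

    lift-approximation : ∀ K d Q → HasDegree d Q → Approximates K d Q remainder →
                         Σ Series (λ P → HasDegree (a + d) P × Approximates K (a + d) P s)
    lift-approximation K d Q Q-deg Q-approx = P , P-deg , P-approx
      where
      open HasDegree Q-deg
      R E P : Series
      R = trunc d (Q ⊛ remainder)
      E = Q ⊛ remainder ⊖ R
      P = Q ⊛ quotient ⊕ X⁻^ a R
      E-small : VanishesBelow (suc (d + (d + K))) E
      E-small = fractionalPart-vanishesBelow (d + K) d (Q ⊛ remainder) Q-approx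
      P-deg : HasDegree (a + d) P
      P-deg = record
        { vanishesAbove = ⊕-vanishesAbove
            (subst (λ e → VanishesAbove e (Q ⊛ quotient)) (ℕP.+-comm d a)
                   (⊛-vanishesAbove d a vanishesAbove (HasDegree.vanishesAbove quotient-degree)))
            (X⁻^-vanishesAbove a (trunc-vanishesAbove d (Q ⊛ remainder)))
        ; leading≉0 = λ P₀≈0 → *-≉0 leading≉0 (HasDegree.leading≉0 quotient-degree) (begin
            Q 0 ℤ.* quotient 0               ≈⟨ ≈-sym (⊛-leading 0 0 (vanishesBelow-0 Q) (vanishesBelow-0 quotient)) ⟩
            (Q ⊛ quotient) 0                 ≡⟨ sym (ℤP.+-identityʳ _) ⟩
            (Q ⊛ quotient) 0 ℤ.+ 0ℤ          ≡⟨ cong (λ x → (Q ⊛ quotient) 0 ℤ.+ x) (sym (X⁻^-< a R 0 order>0)) ⟩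
            P 0                              ≈⟨ P₀≈0 ⟩
            0ℤ                               ∎) }
        where open SetoidReasoning ≈-setoid
      P-approx : Approximates K (a + d) P s
      P-approx i i<a+d+K = begin
        (P ⊛ s) (suc (a + d + i))                      ≈⟨ lift-identity Q R (suc (a + d + i)) ⟩
        X⁻^ a (Q ⊖ E ⊛ s) (suc (a + d + i))            ≡⟨ cong (X⁻^ a (Q ⊖ E ⊛ s)) (reindex a d i) ⟩
        X⁻^ a (Q ⊖ E ⊛ s) (a + suc (d + i))            ≡⟨ X⁻^-+ a (Q ⊖ E ⊛ s) (suc (d + i)) ⟩
        Q (suc (d + i)) ℤ.- (E ⊛ s) (suc (d + i))      ≈⟨ +-cong (vanishesAbove (suc (d + i)) (s≤s (ℕP.m≤m+n d i)))
                                                                 (neg-cong (⊛-vanishesBelow _ a E-small below-order _ bound)) ⟩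
        0ℤ                                             ∎
        where
        open SetoidReasoning ≈-setoid
        reindex : ∀ a d i → suc (a + d + i) ≡ a + suc (d + i)
        reindex = ℕSolver.solve-∀
        reorder : ∀ a d K → d + (a + d + K) ≡ d + (d + K) + a
        reorder = ℕSolver.solve-∀
        bound : suc (d + i) < suc (d + (d + K)) + a
        bound = s≤s (subst (suc (d + i) ≤_) (reorder a d K) (ℕP.+-monoʳ-< d i<a+d+K))

    -- Up to the shifts aligning degrees, this is P s′ = P (1/s − ⌊1/s⌋) = Q − (Q s − R)/s − P ⌊1/s⌋
    -- for R = P, where 1/s = X^a τ.
    descend-identity : ∀ Q P R → R ≋ X⁻^ a P →
      X⁻^ a (X⁻^ a (P ⊛ remainder)) ≋ X⁻^ a Q ⊖ (Q ⊛ s ⊖ R) ⊛ τ ⊖ X⁻^ a (P ⊛ quotient)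
    descend-identity Q P R R≋X⁻^P = begin
      X⁻^ a (X⁻^ a (P ⊛ remainder))                ≈⟨ ≗⇒≋ (X⁻^-cong a (λ n → sym (⊛-X⁻^ a P remainder n))) ⟩
      X⁻^ a (P ⊛ X⁻^ a remainder)                  ≈⟨ ≗⇒≋ (λ n → sym (X⁻^-⊛ a P (X⁻^ a remainder) n)) ⟩
      X⁻^ a P ⊛ X⁻^ a remainder                    ≈⟨ ⊛-cong (λ n → ≈-sym (R≋X⁻^P n)) X⁻^remainder≋τ⊖quotient ⟩
      R ⊛ (τ ⊖ quotient)                           ≈⟨ ≗⇒≋ (⊛-distribˡ-⊖ R τ quotient) ⟩
      R ⊛ τ ⊖ R ⊛ quotient                         ≈⟨ ⊖-cong (≗⇒≋ R⊛τ) R⊛quotient ⟩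
      Q ⊛ s ⊛ τ ⊖ (Q ⊛ s ⊖ R) ⊛ τ ⊖ X⁻^ a (P ⊛ quotient)
                                                   ≈⟨ ⊖-cong (⊖-cong (⊛s⊛τ Q) (≋-refl {(Q ⊛ s ⊖ R) ⊛ τ})) (≋-refl {X⁻^ a (P ⊛ quotient)}) ⟩
      X⁻^ a Q ⊖ (Q ⊛ s ⊖ R) ⊛ τ ⊖ X⁻^ a (P ⊛ quotient)   ∎
      where
      open SetoidReasoning ≋-setoid
      cancel : ∀ t x → t ℤ.- (t ℤ.- x) ≡ x
      cancel = solve-∀
      R⊛τ : R ⊛ τ ≗ Q ⊛ s ⊛ τ ⊖ (Q ⊛ s ⊖ R) ⊛ τ
      R⊛τ n = trans (sumℕ-cong (suc n) (λ k _ → cong (ℤ._* τ (n ∸ k)) (sym (cancel ((Q ⊛ s) k) (R k)))))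
                    (⊛-distribʳ-⊖ (Q ⊛ s) (Q ⊛ s ⊖ R) τ n)
      R⊛quotient : R ⊛ quotient ≋ X⁻^ a (P ⊛ quotient)
      R⊛quotient = ≋-trans (⊛-cong R≋X⁻^P (≋-refl {quotient})) (≗⇒≋ (X⁻^-⊛ a P quotient))

    descend-approximation : ∀ K e Q → HasDegree (a + e) Q → Approximates K (a + e) Q s →
                            Σ Series (λ P → HasDegree e P × Approximates K e P remainder)
    descend-approximation K e Q Q-deg Q-approx = P , P-deg , P-approx
      where
      open HasDegree Q-deg
      d : ℕ
      d = a + e
      R E P : Series
      R = trunc d (Q ⊛ s)
      E = Q ⊛ s ⊖ R
      P n = R (a + n)
      R≋X⁻^P : R ≋ X⁻^ a P
      R≋X⁻^P = vanishesBelow⇒≋X⁻^ a (trunc-vanishesBelow a d (⊛-vanishesBelow 0 a (vanishesBelow-0 Q) below-order))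
      E-small : VanishesBelow (suc (d + (d + K))) E
      E-small = fractionalPart-vanishesBelow (d + K) d (Q ⊛ s) Q-approx
      P-deg : HasDegree e P
      P-deg = record
        { vanishesAbove = λ k e<k → ≡⇒≈ (trunc-> d (Q ⊛ s) (a + k) (ℕP.+-monoʳ-< a e<k))
        ; leading≉0 = λ P₀≈0 → *-≉0 leading≉0 at-order≉0 (begin
            Q 0 ℤ.* s a           ≈⟨ ≈-sym (⊛-leading 0 a (vanishesBelow-0 Q) below-order) ⟩
            (Q ⊛ s) a             ≡⟨ sym (trunc-≤ d (Q ⊛ s) a (ℕP.m≤m+n a e)) ⟩
            R a                   ≡⟨ cong R (sym (ℕP.+-identityʳ a)) ⟩
            P 0                   ≈⟨ P₀≈0 ⟩
            0ℤ                    ∎) }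
        where open SetoidReasoning ≈-setoid
      P-approx : Approximates K e P remainder
      P-approx i i<e+K = begin
        (P ⊛ remainder) n                                        ≡⟨ sym (X⁻^-+ a (P ⊛ remainder) n) ⟩
        X⁻^ a (P ⊛ remainder) (a + n)                            ≡⟨ sym (X⁻^-+ a (X⁻^ a (P ⊛ remainder)) (a + n)) ⟩
        X⁻^ a (X⁻^ a (P ⊛ remainder)) N                          ≈⟨ descend-identity Q P R R≋X⁻^P N ⟩
        X⁻^ a Q N ℤ.- (E ⊛ τ) N ℤ.- X⁻^ a (P ⊛ quotient) N      ≡⟨ cong₂ (λ x y → x ℤ.- (E ⊛ τ) N ℤ.- y)
                                                                      (X⁻^-+ a Q (a + n)) (X⁻^-+ a (P ⊛ quotient) (a + n)) ⟩
        Q (a + n) ℤ.- (E ⊛ τ) N ℤ.- (P ⊛ quotient) (a + n)      ≈⟨ +-cong (+-cong Q-high (neg-cong Eτ-small)) (neg-cong Pquotient-high) ⟩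
        0ℤ                                                       ∎
        where
        open SetoidReasoning ≈-setoid
        n N : ℕ
        n = suc (e + i)
        N = a + (a + n)
        Q-high : Q (a + n) ≈ 0ℤ
        Q-high = vanishesAbove (a + n) (ℕP.+-monoʳ-< a (s≤s (ℕP.m≤m+n e i)))
        reorder : ∀ a e i w → suc (a + (a + suc (e + i))) + w ≡ suc (a + (a + (e + (suc i + w))))
        reorder = ℕSolver.solve-∀
        reorder′ : ∀ a e K → suc (a + (a + (e + (e + K)))) ≡ suc (a + e + (a + e + K)) + 0
        reorder′ = ℕSolver.solve-∀
        bound : N < suc (d + (d + K)) + 0
        bound with ℕP.m≤n⇒∃[o]m+o≡n i<e+K
        ... | w , i+w≡ = subst (N <_) (trans (cong (λ t → suc (a + (a + (e + t)))) i+w≡) (reorder′ a e K))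
                                (subst (suc N ≤_) (reorder a e i w) (ℕP.m≤m+n (suc N) w))
        Eτ-small : (E ⊛ τ) N ≈ 0ℤ
        Eτ-small = ⊛-vanishesBelow (suc (d + (d + K))) 0 E-small (vanishesBelow-0 τ) N bound
        Pquotient-high : (P ⊛ quotient) (a + n) ≈ 0ℤ
        Pquotient-high = ⊛-vanishesAbove e a (HasDegree.vanishesAbove P-deg) (HasDegree.vanishesAbove quotient-degree) (a + n)
                           (subst (_< a + n) (ℕP.+-comm a e) (ℕP.+-monoʳ-< a (s≤s (ℕP.m≤m+n e i))))

    coefficients : ℕ → Fin p
    coefficients = coefficientsOf a quotient

    coef-quotient+L-remainder : coef (poly p a coefficients +L mk 0 remainder) ≋ τ
    coef-quotient+L-remainder n = begin
      coeffAt (poly p a coefficients) (+ n ℤ.- + a) ℤ.+ coeffAt (mk 0 remainder) (+ n ℤ.- + a)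
        ≡⟨ cong₂ ℤ._+_ (cong (atℤ (coef (poly p a coefficients))) (cancel (+ n) (+ a)))
                       (trans (cong (atℤ remainder) (ℤP.+-identityʳ (+ n ℤ.- + a))) (atℤ-X⁻^ remainder n a)) ⟩
      coef (poly p a coefficients) n ℤ.+ X⁻^ a remainder n
        ≈⟨ +-cong (coef-poly a quotient (HasDegree.vanishesAbove quotient-degree) n) (≈-refl {X⁻^ a remainder n}) ⟩
      quotient n ℤ.+ X⁻^ a remainder n
        ≡⟨ cong (ℤ._+ X⁻^ a remainder n) (quotient≗τ⊖X⁻^remainder n) ⟩
      τ n ℤ.- X⁻^ a remainder n ℤ.+ X⁻^ a remainder n
        ≡⟨ cancel (τ n) (X⁻^ a remainder n) ⟩
      τ n ∎
      where
      open SetoidReasoning ≈-setoid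
      cancel : ∀ x y → x ℤ.- y ℤ.+ y ≡ x
      cancel = solve-∀

    partialQuotient-step : ∀ i → coeffAt (mk 0 s *L (poly p a coefficients +L mk 0 remainder)) i ≈ coeffAt oneL i
    partialQuotient-step = ≋X⁻^one⇒≈oneL _ (≋-trans (⊛-cong (≋-refl {s}) coef-quotient+L-remainder) s⊛τ≋X⁻^one)

  -- Bounded partial quotients

  badlyApproximable-remainder : ∀ {K s} (o : PositiveOrder s) →
    BadlyApproximable K s → BadlyApproximable K (PartialQuotient.remainder o)
  badlyApproximable-remainder {K} o bad d Q Q-deg Q-approx =
    let P , P-deg , P-approx = PartialQuotient.lift-approximation o K d Q Q-deg Q-approx
    in  bad (PositiveOrder.order o + d) P P-deg P-approx

  firstNonzero : ∀ s b → VanishesBelow b s ⊎ Σ ℕ (λ n → VanishesBelow n s × s n ≉0)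
  firstNonzero s zero    = inj₁ (λ _ ())
  firstNonzero s (suc b) with firstNonzero s b
  ... | inj₂ found = inj₂ found
  ... | inj₁ s<b with s b ≈0?
  ...   | no  s-b≉0 = inj₂ (b , s<b , s-b≉0)
  ...   | yes s-b≈0 = inj₁ (λ n n<1+b → <1+n-cases n<1+b s-b≈0 (s<b n))

  one-degree : HasDegree 0 one
  one-degree = record { vanishesAbove = λ { (suc _) _ → ≈-refl } ; leading≉0 = 1≉0 }

  -- Q = 1 shows that one of the first K + 1 coefficients is nonzero.
  badlyApproximable⇒positiveOrder : ∀ {K s} → s 0 ≈ 0ℤ → BadlyApproximable K s → PositiveOrder s
  badlyApproximable⇒positiveOrder {K} {s} s₀≈0 bad with firstNonzero s (suc K)
  ... | inj₁ s<1+K = ⊥-elim (bad 0 one one-degree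
                       (λ i i<K → ≈-trans (≡⇒≈ (⊛-identityˡ s (suc i))) (s<1+K (suc i) (s≤s i<K))))
  ... | inj₂ (zero  , _   , s₀≉0) = contradiction s₀≈0 s₀≉0
  ... | inj₂ (suc n , s<n , s-n≉0) = record
    { pred-order = n ; below-order = s<n ; at-order≉0 = s-n≉0 }

  record BadlyApproximableFraction (K : ℕ) : Set where
    field
      series     : Series
      fractional : series 0 ≈ 0ℤ
      badly      : BadlyApproximable K series

    positiveOrder : PositiveOrder series
    positiveOrder = badlyApproximable⇒positiveOrder fractional badly

    open PositiveOrder positiveOrder public using (order)

  next : ∀ {K} → BadlyApproximableFraction K → BadlyApproximableFraction K
  next x = record
    { series     = PartialQuotient.remainder positiveOrder
    ; fractional = ≈-refl
    ; badly      = badlyApproximable-remainder positiveOrder badly }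
    where open BadlyApproximableFraction x

  iterate : ∀ {K} → BadlyApproximableFraction K → ℕ → BadlyApproximableFraction K
  iterate x zero    = x
  iterate x (suc j) = next (iterate x j)

  -- The leading term of Q s sits at X^(d-a), within the range that Approximates controls.
  belowOrder⇒badlyApproximableAt : ∀ K {s} a d → VanishesBelow a s → s a ≉0 → a ≤ K → d < a →
                                   BadlyApproximableAt K s d
  belowOrder⇒badlyApproximableAt K {s} a d s<a s-a≉0 a≤K d<a Q Q-deg Q-approx with ℕP.m≤n⇒∃[o]m+o≡n d<a
  ... | i , refl = *-≉0 (HasDegree.leading≉0 Q-deg) s-a≉0 (begin
    Q 0 ℤ.* s (suc d + i)       ≈⟨ ≈-sym (⊛-leading 0 (suc d + i) (vanishesBelow-0 Q) s<a) ⟩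
    (Q ⊛ s) (suc (d + i))       ≈⟨ Q-approx i i<d+K ⟩
    0ℤ                          ∎)
    where
    open SetoidReasoning ≈-setoid
    i<d+K : i < d + K
    i<d+K = ℕP.<-≤-trans (ℕP.m<n+m i (s≤s z≤n)) (ℕP.≤-trans a≤K (ℕP.m≤n+m K d))

  module BoundedQuotients {k} (x : BadlyApproximableFraction k) (K : ℕ)
                          (bounded : ∀ j → BadlyApproximableFraction.order (iterate x j) ≤ K) where
    open BadlyApproximableFraction using (series; positiveOrder; order)

    sᵢ : ℕ → Series
    sᵢ j = series (iterate x j)

    low-degree : ∀ j d → d < order (iterate x j) → BadlyApproximableAt K (sᵢ j) d
    low-degree j d d<a = belowOrder⇒badlyApproximableAt K (order (iterate x j)) d below-order at-order≉0 (bounded j) d<a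
      where open PositiveOrder (positiveOrder (iterate x j)) using (below-order; at-order≉0)

    high-degree : ∀ j e → BadlyApproximableAt K (sᵢ (suc j)) e → BadlyApproximableAt K (sᵢ j) (order (iterate x j) + e)
    high-degree j e bad Q Q-deg Q-approx =
      let P , P-deg , P-approx = PartialQuotient.descend-approximation (positiveOrder (iterate x j)) K e Q Q-deg Q-approx
      in  bad P P-deg P-approx

    badlyApproximableAt : ∀ d j → BadlyApproximableAt K (sᵢ j) d
    badlyApproximableAt = <-rec _ by-degree
      where
      by-degree : ∀ d → (∀ {e} → e < d → ∀ j → BadlyApproximableAt K (sᵢ j) e) → ∀ j → BadlyApproximableAt K (sᵢ j) d
      by-degree d ih j with order (iterate x j) ℕ.≤? d
      ... | no  a≰d = low-degree j d (ℕP.≰⇒> a≰d)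
      ... | yes a≤d with ℕP.m≤n⇒∃[o]m+o≡n a≤d
      ...   | e , refl = high-degree j e (ih (ℕP.m<n+m e (PositiveOrder.order>0 (positiveOrder (iterate x j)))) (suc j))

  counterexample⇒badlyApproximable : ∀ θ → Counterexample p θ → ∃[ k ] ∀ r → BadlyApproximable k (fractionalSeries θ r)
  counterexample⇒badlyApproximable θ (k , counterexample) = k , badly
    where
    badly : ∀ r → BadlyApproximable k (fractionalSeries θ r)
    badly r d Q Q-deg Q-approx = refute (counterexample r d (coefficientsOf d Q) (coefficientsOf-leading d Q leading≉0))
      where
      open HasDegree Q-deg
      P G : LSeries
      P = poly p d (coefficientsOf d Q)
      G = Xpow r *L (P *L toL θ)
      c : ℕ
      c = r + lshift θ
      reindex : ∀ i r d s → suc i + (r + (d + s)) ≡ suc (d + i) + (r + s)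
      reindex = ℕSolver.solve-∀
      coefficient≈0 : ∀ i → i < d + k → coeffAt (frac G) (+ suc i) ≈ 0ℤ
      coefficient≈0 i i<d+k = begin
        coeffAt (frac G) (+ suc i)                      ≡⟨ coeffAt-frac G i ⟩
        coef G (suc i + (r + (d + lshift θ)))           ≡⟨ coef-Xpow-*L r (P *L toL θ) (suc i + (r + (d + lshift θ))) ⟩
        (coef P ⊛ coef (toL θ)) (suc i + (r + (d + lshift θ)))
                                                        ≡⟨ cong (coef P ⊛ coef (toL θ)) (reindex i r d (lshift θ)) ⟩
        (coef P ⊛ coef (toL θ)) (suc (d + i) + c)       ≈⟨ ⊛-cong (coef-poly d Q vanishesAbove) (≋-refl {coef (toL θ)}) (suc (d + i) + c) ⟩
        (Q ⊛ coef (toL θ)) (suc (d + i) + c)            ≈⟨ ⊛-fractional-shift d (coef (toL θ)) (fractionalSeries θ r) c vanishesAbove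
                                                             (λ m → coef-Xpow-*L r (toL θ) (suc m + c)) i ⟩
        (Q ⊛ fractionalSeries θ r) (suc (d + i))        ≈⟨ Q-approx i i<d+k ⟩
        0ℤ                                              ∎
        where open SetoidReasoning ≈-setoid
      refute : ∃[ i ] (1 ≤ i × i ≤ d + k × ¬ IsZeroₚ p (coeffAt (frac G) (+ i))) → ⊥
      refute (suc i , _ , i<d+k , nonzero) = nonzero (≈0⇒isZero (coefficient≈0 i i<d+k))

  continuedFraction : ∀ {K} (x : BadlyApproximableFraction K) → CFExpansion p (mk 0 (BadlyApproximableFraction.series x))
  continuedFraction x = record
    { pqDeg   = λ j → order (iterate x j)
    ; pqCoef  = λ j → PartialQuotient.coefficients (oᵢ j)
    ; pqLead  = λ j → coefficientsOf-leading (order (iterate x j)) (PartialQuotient.quotient (oᵢ j))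
                        (HasDegree.leading≉0 (PartialQuotient.quotient-degree (oᵢ j)))
    ; rem     = λ j → mk 0 (series (iterate x j))
    ; rem₀    = λ i → ≈⇒≡[p] (≈-refl {coeffAt (mk 0 (series x)) i})
    ; remFrac = λ j i → ≈⇒≡[p] (fractional⇒≈frac (series (iterate x j)) (fractional (iterate x j)) i)
    ; step    = λ j i → ≈⇒≡[p] (PartialQuotient.partialQuotient-step (oᵢ j) i) }
    where
    open BadlyApproximableFraction
    oᵢ : ∀ j → PositiveOrder (series (iterate x j))
    oᵢ j = positiveOrder (iterate x j)

  badlyApproximable-bounded : ∀ θ D → Counterexample p θ → PQBound p θ D →
                              ∀ r → BadlyApproximable (suc D) (fractionalSeries θ r)
  badlyApproximable-bounded θ D counterexample bounded r d =
    BoundedQuotients.badlyApproximableAt x (suc D) (bounded r (continuedFraction x)) d 0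
    where
    k : ℕ
    k = proj₁ (counterexample⇒badlyApproximable θ counterexample)
    x : BadlyApproximableFraction k
    x = record { series = fractionalSeries θ r ; fractional = ≈-refl
               ; badly = proj₂ (counterexample⇒badlyApproximable θ counterexample) r }

  -- The digital net

  lastNonzero : ∀ (b : ℕ → ℤ) n →
    (∀ j → j < n → b j ≈ 0ℤ) ⊎ Σ ℕ (λ d → d < n × b d ≉0 × (∀ j → d < j → j < n → b j ≈ 0ℤ))
  lastNonzero b zero    = inj₁ (λ _ ())
  lastNonzero b (suc n) with b n ≈0?
  ... | no  b-n≉0 = inj₂ (n , ℕP.≤-refl , b-n≉0 , λ j n<j j<1+n → contradiction (ℕP.≤-pred j<1+n) (ℕP.<⇒≱ n<j))
  ... | yes b-n≈0 = Sum.map (λ b<n j j<1+n → <1+n-cases j<1+n b-n≈0 (b<n j))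
                            (λ (d , d<n , b-d≉0 , above) →
                               d , ℕP.m<n⇒m<1+n d<n , b-d≉0 , λ j d<j j<1+n → <1+n-cases j<1+n b-n≈0 (above j d<j))
                            (lastNonzero b n)

  sum₃≈0⇒first≈0 : ∀ {x y z} → x ℤ.+ y ℤ.+ z ≈ 0ℤ → y ≈ 0ℤ → z ≈ 0ℤ → x ≈ 0ℤ
  sum₃≈0⇒first≈0 {x} {y} {z} sum≈0 y≈0 z≈0 =
    ≈-trans (≡⇒≈ (sym (isolate x y z))) (+-cong (+-cong sum≈0 (neg-cong y≈0)) (neg-cong z≈0))
    where
    isolate : ∀ x y z → x ℤ.+ y ℤ.+ z ℤ.- y ℤ.- z ≡ x
    isolate = solve-∀

  sum₃≈0⇒second≈0 : ∀ {x y z} → x ℤ.+ y ℤ.+ z ≈ 0ℤ → x ≈ 0ℤ → z ≈ 0ℤ → y ≈ 0ℤ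
  sum₃≈0⇒second≈0 {x} {y} {z} sum≈0 x≈0 z≈0 =
    ≈-trans (≡⇒≈ (sym (isolate x y z))) (+-cong (+-cong sum≈0 (neg-cong x≈0)) (neg-cong z≈0))
    where
    isolate : ∀ x y z → x ℤ.+ y ℤ.+ z ℤ.- x ℤ.- z ≡ y
    isolate = solve-∀

  sum₃≈0⇒third≈0 : ∀ {x y z} → x ℤ.+ y ℤ.+ z ≈ 0ℤ → x ≈ 0ℤ → y ≈ 0ℤ → z ≈ 0ℤ
  sum₃≈0⇒third≈0 {x} {y} {z} sum≈0 x≈0 y≈0 =
    ≈-trans (≡⇒≈ (sym (isolate x y z))) (+-cong (+-cong sum≈0 (neg-cong x≈0)) (neg-cong y≈0))
    where
    isolate : ∀ x y z → x ℤ.+ y ℤ.+ z ℤ.- x ℤ.- y ≡ z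
    isolate = solve-∀

  module HankelNet (θ : FpLaurent p) (D m d₁ d₂ d₃ : ℕ) (fits : d₁ + d₂ + d₃ + D ≤ m)
                   (badly : BadlyApproximable (suc D) (fractionalSeries θ d₁)) (A : ℕ → ℤ)
                   (columns≈0 : ∀ c → sumℕ (d₁ + d₂ + d₃)
                                  (λ k → A k ℤ.* stackRow (Imat m) (Hmat (toL θ) m) (Jmat m) d₁ d₂ k c) ≈ 0ℤ)
                   where

    a B C : ℕ → ℤ
    a n = coeffAt (toL θ) (+ n)
    B j = A (d₁ + j)
    C j = A (d₁ + d₂ + j)

    Isum Hsum Jsum : ℕ → ℤ
    Isum c = sumℕ d₁ (λ k → A k ℤ.* δ k c)
    Hsum c = sumℕ d₂ (λ j → B j ℤ.* a (suc j + c))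
    Jsum c = sumℕ d₃ (λ j → C j ℤ.* δ (suc (j + c)) m)

    column≈0 : ∀ c → c < m → Isum c ℤ.+ Hsum c ℤ.+ Jsum c ≈ 0ℤ
    column≈0 c c<m = ≈-trans (≡⇒≈ (sym split)) (columns≈0 c′)
      where
      c′ : Fin m
      c′ = fromℕ< c<m
      Iₘ Hₘ Jₘ : Mat m
      Iₘ = Imat m
      Hₘ = Hmat (toL θ) m
      Jₘ = Jmat m
      f : ℕ → ℤ
      f k = A k ℤ.* stackRow Iₘ Hₘ Jₘ d₁ d₂ k c′
      entry : ∀ {k x y} → x ≡ y → A k ℤ.* x ≡ A k ℤ.* y
      entry = cong (A _ ℤ.*_)
      toℕc′ = FinP.toℕ-fromℕ< c<m
      split : sumℕ (d₁ + d₂ + d₃) f ≡ Isum c ℤ.+ Hsum c ℤ.+ Jsum c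
      split = begin
        sumℕ (d₁ + d₂ + d₃) f                                                        ≡⟨ sumℕ-split (d₁ + d₂) d₃ f ⟩
        sumℕ (d₁ + d₂) f ℤ.+ sumℕ d₃ (λ j → f (d₁ + d₂ + j))                         ≡⟨ cong (ℤ._+ sumℕ d₃ (λ j → f (d₁ + d₂ + j))) (sumℕ-split d₁ d₂ f) ⟩
        sumℕ d₁ f ℤ.+ sumℕ d₂ (λ j → f (d₁ + j)) ℤ.+ sumℕ d₃ (λ j → f (d₁ + d₂ + j))
          ≡⟨ cong₂ ℤ._+_ (cong₂ ℤ._+_
               (sumℕ-cong d₁ (λ k k<d₁ → entry (trans (stackRow-upper Iₘ Hₘ Jₘ d₁ d₂ c′ k k<d₁) (cong (δ k) toℕc′))))
               (sumℕ-cong d₂ (λ j j<d₂ → entry (trans (stackRow-middle Iₘ Hₘ Jₘ d₁ d₂ c′ j j<d₂) (cong (λ t → a (suc j + t)) toℕc′)))))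
               (sumℕ-cong d₃ (λ j _ → entry (trans (stackRow-lower Iₘ Hₘ Jₘ d₁ d₂ c′ j) (cong (λ t → δ (suc (j + t)) m) toℕc′)))) ⟩
        Isum c ℤ.+ Hsum c ℤ.+ Jsum c                                                  ∎
        where open ≡-Reasoning

    Isum-≥ : ∀ c → d₁ ≤ c → Isum c ≈ 0ℤ
    Isum-≥ c d₁≤c = sumℕ-≈0 d₁ (λ k k<d₁ → ≡⇒≈ (trans (cong (A k ℤ.*_) (δ-≢ k c (ℕP.<⇒≢ (ℕP.<-≤-trans k<d₁ d₁≤c))))
                                                     (ℤP.*-zeroʳ (A k))))

    Isum-< : ∀ c → c < d₁ → Isum c ≈ A c
    Isum-< c c<d₁ = ≈-trans
      (sumℕ-single d₁ c c<d₁ (λ k _ k≢c → ≡⇒≈ (trans (cong (A k ℤ.*_) (δ-≢ k c k≢c)) (ℤP.*-zeroʳ (A k)))))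
      (≡⇒≈ (trans (cong (A c ℤ.*_) (δ-≡ c)) (ℤP.*-identityʳ (A c))))

    Hsum-0 : (∀ j → j < d₂ → B j ≈ 0ℤ) → ∀ c → Hsum c ≈ 0ℤ
    Hsum-0 B≈0 c = sumℕ-≈0 d₂ (λ j j<d₂ → x≈0⇒x*y≈0 _ (B≈0 j j<d₂))

    Jsum-< : ∀ c → d₃ + c < m → Jsum c ≈ 0ℤ
    Jsum-< c d₃+c<m = sumℕ-≈0 d₃ (λ j j<d₃ → ≡⇒≈ (trans
      (cong (C j ℤ.*_) (δ-≢ _ m (ℕP.<⇒≢ (ℕP.≤-<-trans (ℕP.+-monoˡ-≤ c j<d₃) d₃+c<m))))
      (ℤP.*-zeroʳ (C j))))

    Jsum-at : ∀ c j → j < d₃ → suc (j + c) ≡ m → Jsum c ≈ C j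
    Jsum-at c j j<d₃ hits-m = ≈-trans
      (sumℕ-single d₃ j j<d₃ (λ k _ k≢j → ≡⇒≈ (trans (cong (C k ℤ.*_) (δ-≢ _ m (k≢j ∘ misses k))) (ℤP.*-zeroʳ (C k)))))
      (≡⇒≈ (trans (cong (C j ℤ.*_) (trans (cong (λ t → δ t m) hits-m) (δ-≡ m))) (ℤP.*-identityʳ (C j))))
      where
      misses : ∀ k → suc (k + c) ≡ m → k ≡ j
      misses k k-hits = ℕP.+-cancelʳ-≡ c k j (ℕP.suc-injective (trans k-hits (sym hits-m)))

    d₁+d₃≤m : d₁ + d₃ ≤ m
    d₁+d₃≤m = ℕP.≤-trans (ℕP.+-monoˡ-≤ d₃ (ℕP.m≤m+n d₁ d₂)) (ℕP.≤-trans (ℕP.m≤m+n (d₁ + d₂ + d₃) D) fits)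

    column-in-range : ∀ i → i < d₂ + D → d₃ + (d₁ + i) < m
    column-in-range i i<d₂+D = ℕP.<-≤-trans (ℕP.+-monoʳ-< d₃ (ℕP.+-monoʳ-< d₁ i<d₂+D)) (subst (_≤ m) (reorder d₁ d₂ d₃ D) fits)
      where
      reorder : ∀ d₁ d₂ d₃ D → d₁ + d₂ + d₃ + D ≡ d₃ + (d₁ + (d₂ + D))
      reorder = ℕSolver.solve-∀

    s₀ : Series
    s₀ = fractionalSeries θ d₁

    -- If b_d is the last nonzero coefficient of the H-part, the columns d₁ + i (i ≤ d + D), untouched by
    -- the I- and J-parts, say that Q = Σ_{j≤d} b_j X^j approximates ⟨X^(d₁) θ⟩ too well.
    module LastNonzero (d : ℕ) (d<d₂ : d < d₂) (B-d≉0 : B d ≉0) (above : ∀ j → d < j → j < d₂ → B j ≈ 0ℤ) where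
      Q : Series
      Q = trunc d (B ∘ (d ∸_))

      Q-degree : HasDegree d Q
      Q-degree = record
        { vanishesAbove = trunc-vanishesAbove d (B ∘ (d ∸_))
        ; leading≉0     = B-d≉0 ∘ ≈-trans (≡⇒≈ (sym (trunc-≤ d (B ∘ (d ∸_)) 0 z≤n))) }

      Hsum≈Q⊛s₀ : ∀ i → Hsum (d₁ + i) ≈ (Q ⊛ s₀) (suc (d + i))
      Hsum≈Q⊛s₀ i = begin
        sumℕ d₂ h                               ≡⟨ cong (λ n → sumℕ n h) (sym d₂≡1+d+w) ⟩
        sumℕ (suc d + w) h                      ≈⟨ sumℕ-prefix (suc d) w h (λ j j<w → x≈0⇒x*y≈0 _ (above (suc d + j) (s≤s (ℕP.m≤m+n d j))
                                                      (subst (suc d + j <_) d₂≡1+d+w (ℕP.+-monoʳ-< (suc d) j<w)))) ⟩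
        sumℕ (suc d) h                          ≡⟨ sumℕ-reverse (suc d) h ⟩
        sumℕ (suc d) (λ t → h (d ∸ t))          ≈⟨ sumℕ-≈ (suc d) reversed ⟩
        sumℕ (suc d) G                          ≈⟨ ≈-sym (sumℕ-prefix (suc d) (suc i) G (λ j _ →
                                                      x≈0⇒x*y≈0 _ (trunc-vanishesAbove d (B ∘ (d ∸_)) (suc d + j) (s≤s (ℕP.m≤m+n d j))))) ⟩
        sumℕ (suc d + suc i) G                  ≡⟨ cong (λ n → sumℕ n G) (ℕP.+-suc (suc d) i) ⟩
        (Q ⊛ s₀) (suc (d + i))                  ∎
        where
        open SetoidReasoning ≈-setoid
        w : ℕ
        w = proj₁ (ℕP.m≤n⇒∃[o]m+o≡n d<d₂)
        d₂≡1+d+w : suc d + w ≡ d₂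
        d₂≡1+d+w = proj₂ (ℕP.m≤n⇒∃[o]m+o≡n d<d₂)
        h G : ℕ → ℤ
        h j = B j ℤ.* a (suc j + (d₁ + i))
        G t = Q t ℤ.* s₀ (suc (d + i) ∸ t)
        reorder : ∀ z i d₁ → suc (z + i) + d₁ ≡ suc z + (d₁ + i)
        reorder = ℕSolver.solve-∀
        reversed : ∀ t → t < suc d → h (d ∸ t) ≈ G t
        reversed t (s≤s t≤d) = ≈-sym (*-cong (≡⇒≈ (trunc-≤ d (B ∘ (d ∸_)) t t≤d)) (begin
          s₀ (suc (d + i) ∸ t)          ≡⟨ cong s₀ (suc[d+i]∸j d i t≤d) ⟩
          s₀ (suc (d ∸ t + i))          ≡⟨ fractionalSeries-suc θ d₁ (d ∸ t + i) ⟩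
          a (suc (d ∸ t + i) + d₁)      ≡⟨ cong a (reorder (d ∸ t) i d₁) ⟩
          a (suc (d ∸ t) + (d₁ + i))    ∎))

      Q-approximates : Approximates (suc D) d Q s₀
      Q-approximates i i<d+1+D = ≈-trans (≈-sym (Hsum≈Q⊛s₀ i))
        (sum₃≈0⇒second≈0 (column≈0 (d₁ + i) (ℕP.≤-<-trans (ℕP.m≤n+m (d₁ + i) d₃) in-range))
                         (Isum-≥ (d₁ + i) (ℕP.m≤m+n d₁ i)) (Jsum-< (d₁ + i) in-range))
        where
        in-range : d₃ + (d₁ + i) < m
        in-range = column-in-range i (ℕP.≤-<-trans (ℕP.≤-pred (subst (i <_) (ℕP.+-suc d D) i<d+1+D)) (ℕP.+-monoˡ-< D d<d₂))

    B≈0 : ∀ j → j < d₂ → B j ≈ 0ℤ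
    B≈0 with lastNonzero B d₂
    ... | inj₁ B<d₂                   = B<d₂
    ... | inj₂ (d , d<d₂ , B-d≉0 , above) = ⊥-elim (badly d Q Q-degree Q-approximates)
      where open LastNonzero d d<d₂ B-d≉0 above

    I-part≈0 : ∀ k → k < d₁ → A k ≈ 0ℤ
    I-part≈0 k k<d₁ = ≈-trans (≈-sym (Isum-< k k<d₁))
      (sum₃≈0⇒first≈0 (column≈0 k (ℕP.≤-<-trans (ℕP.m≤n+m k d₃) in-range)) (Hsum-0 B≈0 k) (Jsum-< k in-range))
      where
      in-range : d₃ + k < m
      in-range = ℕP.<-≤-trans (ℕP.+-monoʳ-< d₃ k<d₁) (subst (_≤ m) (ℕP.+-comm d₁ d₃) d₁+d₃≤m)

    J-part≈0 : ∀ j → j < d₃ → C j ≈ 0ℤ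
    J-part≈0 j j<d₃ = ≈-trans (≈-sym (Jsum-at c j j<d₃ j+c≡m))
      (sum₃≈0⇒third≈0 (column≈0 c c<m) (Isum-≥ c d₁≤c) (Hsum-0 B≈0 c))
      where
      1+j≤m : suc j ≤ m
      1+j≤m = ℕP.≤-trans j<d₃ (ℕP.m+n≤o⇒n≤o d₁ d₁+d₃≤m)
      c : ℕ
      c = m ∸ suc j
      j+c≡m : suc (j + c) ≡ m
      j+c≡m = ℕP.m+[n∸m]≡n 1+j≤m
      c<m : c < m
      c<m = subst (c <_) j+c≡m (ℕP.m<n+m c (s≤s z≤n))
      d₁≤c : d₁ ≤ c
      d₁≤c = ℕP.m+n≤o⇒m≤o∸n d₁ (ℕP.≤-trans (ℕP.+-monoʳ-≤ d₁ j<d₃) d₁+d₃≤m)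

    A≈0 : ∀ k → k < d₁ + d₂ + d₃ → A k ≈ 0ℤ
    A≈0 k k<n with k ℕ.<? d₁
    ... | yes k<d₁ = I-part≈0 k k<d₁
    ... | no  k≮d₁ with ℕP.m≤n⇒∃[o]m+o≡n (ℕP.≮⇒≥ k≮d₁)
    ...   | t , refl with t ℕ.<? d₂
    ...     | yes t<d₂ = B≈0 t t<d₂
    ...     | no  t≮d₂ with ℕP.m≤n⇒∃[o]m+o≡n (ℕP.≮⇒≥ t≮d₂)
    ...       | u , refl = subst (λ k → A k ≈ 0ℤ) (ℕP.+-assoc d₁ d₂ u)
                             (J-part≈0 u (ℕP.+-cancelˡ-< (d₁ + d₂) u d₃ (subst (_< d₁ + d₂ + d₃) (sym (ℕP.+-assoc d₁ d₂ u)) k<n)))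

  digitalNet : ∀ θ D m → D < m → (∀ r → BadlyApproximable (suc D) (fractionalSeries θ r)) →
               DigitalNet3 p D m (Imat m) (Hmat (toL θ) m) (Jmat m)
  digitalNet θ D m D<m badly = D<m , fullRowRank
    where
    fullRowRank : ∀ d₁ d₂ d₃ → d₁ + d₂ + d₃ ≤ m ∸ D →
      FullRowRank p (d₁ + d₂ + d₃) m (λ i c → stackRow (Imat m) (Hmat (toL θ) m) (Jmat m) d₁ d₂ (toℕ i) c)
    fullRowRank d₁ d₂ d₃ n≤m∸D coefficients columns i = ≈0⇒isZero (begin
      coefficients i                   ≡⟨ sym (extend-toℕ n coefficients i) ⟩
      extend n coefficients (toℕ i)    ≈⟨ HankelNet.A≈0 θ D m d₁ d₂ d₃ fits (badly d₁) (extend n coefficients) columns≈0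
                                            (toℕ i) (FinP.toℕ<n i) ⟩
      0ℤ                               ∎)
      where
      open SetoidReasoning ≈-setoid
      n : ℕ
      n = d₁ + d₂ + d₃
      fits : n + D ≤ m
      fits = ℕP.m≤o∸n⇒m+n≤o n (ℕP.<⇒≤ D<m) n≤m∸D
      row : ℕ → Fin m → ℤ
      row k c = stackRow (Imat m) (Hmat (toL θ) m) (Jmat m) d₁ d₂ k c
      columns≈0 : ∀ c → sumℕ n (λ k → extend n coefficients k ℤ.* row k c) ≈ 0ℤ
      columns≈0 c = ≈-trans
        (≡⇒≈ (sym (trans (sumFin≡sumℕ-extend n _) (sumℕ-cong n (λ k _ → extend-* n coefficients (λ k → row k c) k)))))
        (isZero⇒≈0 (columns c))

lemma4 : (p : ℕ) → Prime p → (θ : FpLaurent p) → Counterexample p θ →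
         (D : ℕ) → PQBound p θ D →
         (m : ℕ) → D < m →
         DigitalNet3 p D m (Imat m) (Hmat (toL θ) m) (Jmat m)
lemma4 p p-prime θ counterexample D bounded m D<m =
  digitalNet p p-prime θ D m D<m (badlyApproximable-bounded p p-prime θ D counterexample bounded)
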